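{- Let $p$ be an odd prime and let $E$ be an elliptic curve over $\mathbb{F}_p$ given by $y^2=f(x)$ with $f\in\mathbb{F}_p[x]$ a monic cubic without repeated roots. Let $\omega=dx/y$, $\eta=x\,\omega$, and let $\alpha,\beta\in\mathbb{F}_p$ be defined by $C(\omega)=\alpha\omega$ and $C(\eta)=\beta\omega$, where $C$ is the Cartier operator. Then $\alpha$ and $\beta$ are not both zero.
   Context: Cartier operator: for a separating element $t$ of a function field $L$ of characteristic $p$ over a perfect field, every differential is uniquely $(u_0^p+u_1^pt+\dots+u_{p-1}^pt^{p-1})\,dt$ with $u_i\in L$, and $C$ sends it to $u_{p-1}\,dt$ (independent of $t$). For $E$ as stated, $C(\omega)$ and $C(\eta)$ are $\mathbb{F}_p$-multiples of $\omega$, so $\alpha,\beta$ are well defined. -}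

module Defs where

open import Data.Nat using (ℕ; zero; suc; _+_; _*_; _∸_; _<_; NonZero)
open import Data.Nat.DivMod using (_%_)
open import Data.List using (List; []; _∷_; map)
open import Data.Product using (Σ; _×_; ∃)
open import Relation.Binary.PropositionalEquality using (_≡_)
open import Relation.Nullary using (¬_)

-- Polynomials in x over F_p, as coefficient lists of natural numbers
-- (constant term first); coefficients are read modulo p.

Poly : Set
Poly = List ℕ

coeff : Poly → ℕ → ℕ
coeff []       _       = 0
coeff (a ∷ _)  zero    = a
coeff (_ ∷ as) (suc n) = coeff as n

padd : Poly → Poly → Poly
padd []       q        = q
padd (a ∷ as) []       = a ∷ as
padd (a ∷ as) (b ∷ bs) = (a + b) ∷ padd as bs

pscale : ℕ → Poly → Poly
pscale c q = map (c *_) q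

pmul : Poly → Poly → Poly
pmul []       q = []
pmul (a ∷ as) q = padd (pscale a q) (0 ∷ pmul as q)

pderivFrom : ℕ → Poly → Poly
pderivFrom k []       = []
pderivFrom k (a ∷ as) = (k * a) ∷ pderivFrom (suc k) as

pderiv : Poly → Poly
pderiv []       = []
pderiv (_ ∷ as) = pderivFrom 1 as

xpow : ℕ → Poly
xpow zero    = 1 ∷ []
xpow (suc n) = 0 ∷ xpow n

PolyEq : (p : ℕ) .{{_ : NonZero p}} → Poly → Poly → Set
PolyEq p P Q = ∀ n → coeff P n % p ≡ coeff Q n % p

cubic : ℕ → ℕ → ℕ → Poly
cubic a0 a1 a2 = a0 ∷ a1 ∷ a2 ∷ 1 ∷ []

-- f has no repeated roots (is separable): gcd(f, f') = 1 in F_p[x]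
Separable : (p : ℕ) .{{_ : NonZero p}} → Poly → Set
Separable p f = Σ Poly λ s → Σ Poly λ t →
  PolyEq p (padd (pmul s f) (pmul t (pderiv f))) (1 ∷ [])

-- The function field L = F_p(x)[y]/(y^2 - f) of E.
-- An element (a + b y)/d is represented by the triple (a , b , d), d ≠ 0.

record Elt : Set where
  constructor elt
  field
    num0 : Poly
    num1 : Poly
    den  : Poly
open Elt public

NonZeroPoly : (p : ℕ) .{{_ : NonZero p}} → Poly → Set
NonZeroPoly p d = ¬ PolyEq p d []

-- equality in L ({1, y} is a basis of L over F_p(x))
EltEq : (p : ℕ) .{{_ : NonZero p}} → Elt → Elt → Set
EltEq p (elt a b d) (elt a' b' d') =
  PolyEq p (pmul a d') (pmul a' d) × PolyEq p (pmul b d') (pmul b' d)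

eadd : Elt → Elt → Elt
eadd (elt a b d) (elt a' b' d') =
  elt (padd (pmul a d') (pmul a' d)) (padd (pmul b d') (pmul b' d)) (pmul d d')

-- multiplication, using y^2 = f
emul : Poly → Elt → Elt → Elt
emul f (elt a b d) (elt a' b' d') =
  elt (padd (pmul a a') (pmul (pmul b b') f))
      (padd (pmul a b') (pmul b a'))
      (pmul d d')

epow : Poly → Elt → ℕ → Elt
epow f u zero    = elt (1 ∷ []) [] (1 ∷ [])
epow f u (suc n) = emul f (epow f u n) u

eFromPoly : Poly → Elt
eFromPoly q = elt q [] (1 ∷ [])

pBasisSum : (p : ℕ) → Poly → (ℕ → Elt) → ℕ → Elt
pBasisSum p f u zero    = elt [] [] (1 ∷ [])
pBasisSum p f u (suc n) =
  eadd (pBasisSum p f u n) (emul f (epow f (u n) p) (eFromPoly (xpow n)))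

-- Differentials are written h dx (x is a separating element of L).
-- Cartier operator with respect to t = x:
--   C(h dx) = v dx  iff  h = Σ_{i<p} u_i^p x^i with u_i ∈ L and v = u_{p-1}.
-- (The decomposition is unique, so this determines C.)

CartierIs : (p : ℕ) .{{_ : NonZero p}} → (f : Poly) → (h v : Elt) → Set
CartierIs p f h v = Σ (ℕ → Elt) λ u →
  (∀ i → i < p → NonZeroPoly p (den (u i))) ×
  EltEq p h (pBasisSum p f u p) ×
  EltEq p (u (p ∸ 1)) v

-- ω = dx / y, written as h dx with h = 1/y = y/f
omegaCoeff : Poly → Elt
omegaCoeff f = elt [] (1 ∷ []) f

-- η = x ω, coefficient x/y = x y / f
etaCoeff : Poly → Elt
etaCoeff f = elt [] (0 ∷ 1 ∷ []) f

-- c ω, c ∈ F_p, coefficient c/y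
scaledOmegaCoeff : ℕ → Poly → Elt
scaledOmegaCoeff c f = elt [] (c ∷ []) f

{-# OPTIONS --safe #-}
module Submission where

-- With m = (p - 1)/2, ω = f^m dx / y^p, so α and β are the coefficients of x^(p-1) and x^(p-2)
-- in f^m. Concretely: if α = 0, the y-part of the decomposition Σ u_i^p x^i of 1/y, multiplied
-- by f^(m+1) and its p-th-power denominator, is a derivative, which forces the coefficient of
-- x^(p-1) in f^m to vanish; likewise β = 0 for η = x ω. But the two coefficients cannot both
-- vanish: then f^m = L + x^p H with deg L < p - 2, and since f (f^m)′ = m f′ f^m and
-- (x^p)′ = 0, both L and H solve f P′ = m f′ P with deg P < 3m. By separability
-- (s f + t f′ = 1) every solution is f times a solution for m - 1, so L = H = 0, contradicting
-- f^m ≠ 0.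

open import Defs
open import Data.Nat
open import Data.Nat.Properties
open import Data.Nat.DivMod
open import Data.Nat.Divisibility using (_∣_; m%n≡0⇒n∣m; n∣m⇒m%n≡0; ∣m+n∣m⇒∣n; ∣⇒≤)
open import Data.Nat.Primality using (Prime; prime⇒nonTrivial; euclidsLemma; prime⇒irreducible)
open import Data.Nat.Coprimality using (prime⇒coprime; coprime-Bézout)
open import Data.Nat.GCD using (module Bézout)
open import Data.List using ([]; _∷_; take; drop)
open import Data.Product using (Σ; _×_; _,_; proj₁; proj₂)
open import Data.Sum using (_⊎_; inj₁; inj₂)
open import Data.Empty using (⊥; ⊥-elim)
open import Relation.Nullary using (¬_; Dec; yes; no)
open import Relation.Binary.PropositionalEquality
open import Algebra.Bundles using (CommutativeRing)
open import Algebra.Structures using (IsCommutativeRing)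
import Relation.Binary.Reasoning.Setoid as SetoidReasoning

module Coefficientwise where

  open ≡-Reasoning

  infix 4 _≋_
  _≋_ : Poly → Poly → Set
  P ≋ Q = ∀ n → coeff P n ≡ coeff Q n

  hd : Poly → ℕ
  hd []      = 0
  hd (a ∷ _) = a

  tl : Poly → Poly
  tl []       = []
  tl (_ ∷ as) = as

  coeff-zero : ∀ P → coeff P 0 ≡ hd P
  coeff-zero []      = refl
  coeff-zero (a ∷ P) = refl

  coeff-suc : ∀ P n → coeff P (suc n) ≡ coeff (tl P) n
  coeff-suc []      n = refl
  coeff-suc (a ∷ P) n = refl

  coeff-padd : ∀ P Q n → coeff (padd P Q) n ≡ coeff P n + coeff Q n
  coeff-padd []       Q        n       = refl
  coeff-padd (a ∷ as) []       n       = sym (+-identityʳ _)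
  coeff-padd (a ∷ as) (b ∷ bs) zero    = refl
  coeff-padd (a ∷ as) (b ∷ bs) (suc n) = coeff-padd as bs n

  coeff-pscale : ∀ c P n → coeff (pscale c P) n ≡ c * coeff P n
  coeff-pscale c []       n       = sym (*-zeroʳ c)
  coeff-pscale c (a ∷ as) zero    = refl
  coeff-pscale c (a ∷ as) (suc n) = coeff-pscale c as n

  coeff-pmul-zero : ∀ P Q → coeff (pmul P Q) 0 ≡ hd P * hd Q
  coeff-pmul-zero []      Q = refl
  coeff-pmul-zero (a ∷ P) Q = begin
    coeff (padd (pscale a Q) (0 ∷ pmul P Q)) 0  ≡⟨ coeff-padd (pscale a Q) _ 0 ⟩
    coeff (pscale a Q) 0 + 0  ≡⟨ +-identityʳ _ ⟩
    coeff (pscale a Q) 0      ≡⟨ coeff-pscale a Q 0 ⟩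
    a * coeff Q 0             ≡⟨ cong (a *_) (coeff-zero Q) ⟩
    a * hd Q                  ∎

  coeff-pmul-suc : ∀ P Q n →
    coeff (pmul P Q) (suc n) ≡ hd P * coeff Q (suc n) + coeff (pmul (tl P) Q) n
  coeff-pmul-suc []      Q n = refl
  coeff-pmul-suc (a ∷ P) Q n = begin
    coeff (padd (pscale a Q) (0 ∷ pmul P Q)) (suc n)  ≡⟨ coeff-padd (pscale a Q) _ (suc n) ⟩
    coeff (pscale a Q) (suc n) + coeff (pmul P Q) n   ≡⟨ cong (_+ coeff (pmul P Q) n) (coeff-pscale a Q (suc n)) ⟩
    a * coeff Q (suc n) + coeff (pmul P Q) n          ∎

  hd-cong : ∀ P Q → P ≋ Q → hd P ≡ hd Q
  hd-cong P Q e = trans (sym (coeff-zero P)) (trans (e 0) (coeff-zero Q))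

  tl-cong : ∀ P Q → P ≋ Q → tl P ≋ tl Q
  tl-cong P Q e n = trans (sym (coeff-suc P n)) (trans (e (suc n)) (coeff-suc Q n))

  hd-padd : ∀ P Q → hd (padd P Q) ≡ hd P + hd Q
  hd-padd P Q = begin
    hd (padd P Q)              ≡⟨ sym (coeff-zero (padd P Q)) ⟩
    coeff (padd P Q) 0         ≡⟨ coeff-padd P Q 0 ⟩
    coeff P 0 + coeff Q 0      ≡⟨ cong₂ _+_ (coeff-zero P) (coeff-zero Q) ⟩
    hd P + hd Q                ∎

  tl-padd : ∀ P Q → tl (padd P Q) ≋ padd (tl P) (tl Q)
  tl-padd P Q n = begin
    coeff (tl (padd P Q)) n                ≡⟨ sym (coeff-suc (padd P Q) n) ⟩
    coeff (padd P Q) (suc n)               ≡⟨ coeff-padd P Q (suc n) ⟩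
    coeff P (suc n) + coeff Q (suc n)      ≡⟨ cong₂ _+_ (coeff-suc P n) (coeff-suc Q n) ⟩
    coeff (tl P) n + coeff (tl Q) n        ≡⟨ sym (coeff-padd (tl P) (tl Q) n) ⟩
    coeff (padd (tl P) (tl Q)) n           ∎

  hd-pscale : ∀ c P → hd (pscale c P) ≡ c * hd P
  hd-pscale c []      = sym (*-zeroʳ c)
  hd-pscale c (a ∷ P) = refl

  tl-pscale : ∀ c P → tl (pscale c P) ≡ pscale c (tl P)
  tl-pscale c []      = refl
  tl-pscale c (a ∷ P) = refl

  hd-pmul : ∀ P Q → hd (pmul P Q) ≡ hd P * hd Q
  hd-pmul P Q = trans (sym (coeff-zero (pmul P Q))) (coeff-pmul-zero P Q)

  tl-pmul : ∀ P Q → tl (pmul P Q) ≋ padd (pscale (hd P) (tl Q)) (pmul (tl P) Q)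
  tl-pmul P Q n = begin
    coeff (tl (pmul P Q)) n                                      ≡⟨ sym (coeff-suc (pmul P Q) n) ⟩
    coeff (pmul P Q) (suc n)                                     ≡⟨ coeff-pmul-suc P Q n ⟩
    hd P * coeff Q (suc n) + coeff (pmul (tl P) Q) n             ≡⟨ cong (λ z → hd P * z + coeff (pmul (tl P) Q) n) (coeff-suc Q n) ⟩
    hd P * coeff (tl Q) n + coeff (pmul (tl P) Q) n              ≡⟨ cong (_+ coeff (pmul (tl P) Q) n) (sym (coeff-pscale (hd P) (tl Q) n)) ⟩
    coeff (pscale (hd P) (tl Q)) n + coeff (pmul (tl P) Q) n     ≡⟨ sym (coeff-padd (pscale (hd P) (tl Q)) _ n) ⟩
    coeff (padd (pscale (hd P) (tl Q)) (pmul (tl P) Q)) n        ∎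

  pmul-congˡ : ∀ P P' Q → P ≋ P' → pmul P Q ≋ pmul P' Q
  pmul-congˡ P P' Q e zero = begin
    coeff (pmul P Q) 0   ≡⟨ coeff-pmul-zero P Q ⟩
    hd P * hd Q          ≡⟨ cong (_* hd Q) (hd-cong P P' e) ⟩
    hd P' * hd Q         ≡⟨ sym (coeff-pmul-zero P' Q) ⟩
    coeff (pmul P' Q) 0  ∎
  pmul-congˡ P P' Q e (suc n) = begin
    coeff (pmul P Q) (suc n)                            ≡⟨ coeff-pmul-suc P Q n ⟩
    hd P * coeff Q (suc n) + coeff (pmul (tl P) Q) n    ≡⟨ cong₂ _+_ (cong (_* coeff Q (suc n)) (hd-cong P P' e))
                                                                      (pmul-congˡ (tl P) (tl P') Q (tl-cong P P' e) n) ⟩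
    hd P' * coeff Q (suc n) + coeff (pmul (tl P') Q) n  ≡⟨ sym (coeff-pmul-suc P' Q n) ⟩
    coeff (pmul P' Q) (suc n)                           ∎

  pmul-comm : ∀ P Q → pmul P Q ≋ pmul Q P
  pmul-comm P Q zero = begin
    coeff (pmul P Q) 0  ≡⟨ coeff-pmul-zero P Q ⟩
    hd P * hd Q         ≡⟨ *-comm (hd P) (hd Q) ⟩
    hd Q * hd P         ≡⟨ sym (coeff-pmul-zero Q P) ⟩
    coeff (pmul Q P) 0  ∎
  pmul-comm P Q (suc zero) = begin
    coeff (pmul P Q) 1                             ≡⟨ expand P Q ⟩
    hd P * hd (tl Q) + hd (tl P) * hd Q            ≡⟨ +-comm (hd P * _) _ ⟩
    hd (tl P) * hd Q + hd P * hd (tl Q)            ≡⟨ cong₂ _+_ (*-comm (hd (tl P)) _) (*-comm (hd P) _) ⟩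
    hd Q * hd (tl P) + hd (tl Q) * hd P            ≡⟨ sym (expand Q P) ⟩
    coeff (pmul Q P) 1                             ∎
    where
    expand : ∀ P Q → coeff (pmul P Q) 1 ≡ hd P * hd (tl Q) + hd (tl P) * hd Q
    expand P Q = trans (coeff-pmul-suc P Q 0)
      (cong₂ _+_ (cong (hd P *_) (trans (coeff-suc Q 0) (coeff-zero (tl Q)))) (coeff-pmul-zero (tl P) Q))
  pmul-comm P Q (suc (suc n)) = begin
    coeff (pmul P Q) (2 + n)                                  ≡⟨ coeff-pmul-suc P Q (suc n) ⟩
    hd P * coeff Q (2 + n) + coeff (pmul (tl P) Q) (suc n)    ≡⟨ cong (a +_) (pmul-comm (tl P) Q (suc n)) ⟩
    hd P * coeff Q (2 + n) + coeff (pmul Q (tl P)) (suc n)    ≡⟨ cong (a +_) (coeff-pmul-suc Q (tl P) n) ⟩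
    hd P * coeff Q (2 + n) + (hd Q * coeff (tl P) (suc n) + coeff (pmul (tl Q) (tl P)) n)
      ≡⟨ cong₂ (λ u v → hd P * u + (hd Q * v + coeff (pmul (tl Q) (tl P)) n)) (coeff-suc Q (suc n)) (sym (coeff-suc P (suc n))) ⟩
    hd P * coeff (tl Q) (suc n) + (hd Q * coeff P (2 + n) + coeff (pmul (tl Q) (tl P)) n)
      ≡⟨ cong (λ w → a' + (b + w)) (pmul-comm (tl Q) (tl P) n) ⟩
    hd P * coeff (tl Q) (suc n) + (hd Q * coeff P (2 + n) + coeff (pmul (tl P) (tl Q)) n)
      ≡⟨ +-exchange a' b (coeff (pmul (tl P) (tl Q)) n) ⟩
    hd Q * coeff P (2 + n) + (hd P * coeff (tl Q) (suc n) + coeff (pmul (tl P) (tl Q)) n)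
      ≡⟨ cong (b +_) (sym (coeff-pmul-suc P (tl Q) n)) ⟩
    hd Q * coeff P (2 + n) + coeff (pmul P (tl Q)) (suc n)    ≡⟨ cong (b +_) (pmul-comm P (tl Q) (suc n)) ⟩
    hd Q * coeff P (2 + n) + coeff (pmul (tl Q) P) (suc n)    ≡⟨ sym (coeff-pmul-suc Q P (suc n)) ⟩
    coeff (pmul Q P) (2 + n)                                  ∎
    where
    a = hd P * coeff Q (2 + n)
    a' = hd P * coeff (tl Q) (suc n)
    b = hd Q * coeff P (2 + n)
    +-exchange : ∀ a b c → a + (b + c) ≡ b + (a + c)
    +-exchange a b c = trans (sym (+-assoc a b c)) (trans (cong (_+ c) (+-comm a b)) (+-assoc b a c))

  pmul-distribʳ : ∀ P P' Q → pmul (padd P P') Q ≋ padd (pmul P Q) (pmul P' Q)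
  pmul-distribʳ P P' Q zero = begin
    coeff (pmul (padd P P') Q) 0                 ≡⟨ coeff-pmul-zero (padd P P') Q ⟩
    hd (padd P P') * hd Q                        ≡⟨ cong (_* hd Q) (hd-padd P P') ⟩
    (hd P + hd P') * hd Q                        ≡⟨ *-distribʳ-+ (hd Q) (hd P) (hd P') ⟩
    hd P * hd Q + hd P' * hd Q                   ≡⟨ sym (cong₂ _+_ (coeff-pmul-zero P Q) (coeff-pmul-zero P' Q)) ⟩
    coeff (pmul P Q) 0 + coeff (pmul P' Q) 0     ≡⟨ sym (coeff-padd (pmul P Q) (pmul P' Q) 0) ⟩
    coeff (padd (pmul P Q) (pmul P' Q)) 0        ∎
  pmul-distribʳ P P' Q (suc n) = begin
    coeff (pmul (padd P P') Q) (suc n)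
      ≡⟨ coeff-pmul-suc (padd P P') Q n ⟩
    hd (padd P P') * q + coeff (pmul (tl (padd P P')) Q) n
      ≡⟨ cong₂ _+_ (cong (_* q) (hd-padd P P')) (pmul-congˡ (tl (padd P P')) (padd (tl P) (tl P')) Q (tl-padd P P') n) ⟩
    (hd P + hd P') * q + coeff (pmul (padd (tl P) (tl P')) Q) n
      ≡⟨ cong₂ _+_ (*-distribʳ-+ q (hd P) (hd P')) (pmul-distribʳ (tl P) (tl P') Q n) ⟩
    (hd P * q + hd P' * q) + coeff (padd (pmul (tl P) Q) (pmul (tl P') Q)) n
      ≡⟨ cong (hd P * q + hd P' * q +_) (coeff-padd (pmul (tl P) Q) (pmul (tl P') Q) n) ⟩
    (hd P * q + hd P' * q) + (coeff (pmul (tl P) Q) n + coeff (pmul (tl P') Q) n)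
      ≡⟨ +-assoc-middle (hd P * q) (hd P' * q) _ _ ⟩
    (hd P * q + coeff (pmul (tl P) Q) n) + (hd P' * q + coeff (pmul (tl P') Q) n)
      ≡⟨ sym (cong₂ _+_ (coeff-pmul-suc P Q n) (coeff-pmul-suc P' Q n)) ⟩
    coeff (pmul P Q) (suc n) + coeff (pmul P' Q) (suc n)
      ≡⟨ sym (coeff-padd (pmul P Q) (pmul P' Q) (suc n)) ⟩
    coeff (padd (pmul P Q) (pmul P' Q)) (suc n)
      ∎
    where
    q = coeff Q (suc n)
    +-assoc-middle : ∀ a b c d → (a + b) + (c + d) ≡ (a + c) + (b + d)
    +-assoc-middle = solve-∀
      where open import Data.Nat.Tactic.RingSolver

  pmul-pscale : ∀ c P R → pmul (pscale c P) R ≋ pscale c (pmul P R)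
  pmul-pscale c P R zero = begin
    coeff (pmul (pscale c P) R) 0   ≡⟨ coeff-pmul-zero (pscale c P) R ⟩
    hd (pscale c P) * hd R          ≡⟨ cong (_* hd R) (hd-pscale c P) ⟩
    c * hd P * hd R                 ≡⟨ *-assoc c (hd P) (hd R) ⟩
    c * (hd P * hd R)               ≡⟨ cong (c *_) (sym (coeff-pmul-zero P R)) ⟩
    c * coeff (pmul P R) 0          ≡⟨ sym (coeff-pscale c (pmul P R) 0) ⟩
    coeff (pscale c (pmul P R)) 0   ∎
  pmul-pscale c P R (suc n) = begin
    coeff (pmul (pscale c P) R) (suc n)
      ≡⟨ coeff-pmul-suc (pscale c P) R n ⟩
    hd (pscale c P) * r + coeff (pmul (tl (pscale c P)) R) n
      ≡⟨ cong₂ _+_ (cong (_* r) (hd-pscale c P)) (cong (λ z → coeff (pmul z R) n) (tl-pscale c P)) ⟩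
    c * hd P * r + coeff (pmul (pscale c (tl P)) R) n
      ≡⟨ cong₂ _+_ (*-assoc c (hd P) r) (trans (pmul-pscale c (tl P) R n) (coeff-pscale c (pmul (tl P) R) n)) ⟩
    c * (hd P * r) + c * coeff (pmul (tl P) R) n
      ≡⟨ sym (*-distribˡ-+ c (hd P * r) _) ⟩
    c * (hd P * r + coeff (pmul (tl P) R) n)
      ≡⟨ cong (c *_) (sym (coeff-pmul-suc P R n)) ⟩
    c * coeff (pmul P R) (suc n)
      ≡⟨ sym (coeff-pscale c (pmul P R) (suc n)) ⟩
    coeff (pscale c (pmul P R)) (suc n)
      ∎
    where r = coeff R (suc n)

  pmul-assoc : ∀ P Q R → pmul (pmul P Q) R ≋ pmul P (pmul Q R)
  pmul-assoc P Q R zero = begin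
    coeff (pmul (pmul P Q) R) 0        ≡⟨ coeff-pmul-zero (pmul P Q) R ⟩
    hd (pmul P Q) * hd R               ≡⟨ cong (_* hd R) (hd-pmul P Q) ⟩
    hd P * hd Q * hd R                 ≡⟨ *-assoc (hd P) (hd Q) (hd R) ⟩
    hd P * (hd Q * hd R)               ≡⟨ cong (hd P *_) (sym (hd-pmul Q R)) ⟩
    hd P * hd (pmul Q R)               ≡⟨ sym (coeff-pmul-zero P (pmul Q R)) ⟩
    coeff (pmul P (pmul Q R)) 0        ∎
  pmul-assoc P Q R (suc n) = begin
    coeff (pmul (pmul P Q) R) (suc n)
      ≡⟨ coeff-pmul-suc (pmul P Q) R n ⟩
    hd (pmul P Q) * r + coeff (pmul (tl (pmul P Q)) R) n
      ≡⟨ cong₂ _+_ (cong (_* r) (hd-pmul P Q)) (pmul-congˡ (tl (pmul P Q)) (padd (pscale (hd P) (tl Q)) (pmul (tl P) Q)) R (tl-pmul P Q) n) ⟩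
    hd P * hd Q * r + coeff (pmul (padd (pscale (hd P) (tl Q)) (pmul (tl P) Q)) R) n
      ≡⟨ cong₂ _+_ (*-assoc (hd P) (hd Q) r) (pmul-distribʳ (pscale (hd P) (tl Q)) (pmul (tl P) Q) R n) ⟩
    hd P * (hd Q * r) + coeff (padd (pmul (pscale (hd P) (tl Q)) R) (pmul (pmul (tl P) Q) R)) n
      ≡⟨ cong (hd P * (hd Q * r) +_) (coeff-padd (pmul (pscale (hd P) (tl Q)) R) (pmul (pmul (tl P) Q) R) n) ⟩
    hd P * (hd Q * r) + (coeff (pmul (pscale (hd P) (tl Q)) R) n + coeff (pmul (pmul (tl P) Q) R) n)
      ≡⟨ cong (hd P * (hd Q * r) +_) (cong₂ _+_ (trans (pmul-pscale (hd P) (tl Q) R n) (coeff-pscale (hd P) (pmul (tl Q) R) n))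
                                (pmul-assoc (tl P) Q R n)) ⟩
    hd P * (hd Q * r) + (hd P * coeff (pmul (tl Q) R) n + coeff (pmul (tl P) (pmul Q R)) n)
      ≡⟨ sym (+-assoc (hd P * (hd Q * r)) _ _) ⟩
    hd P * (hd Q * r) + hd P * coeff (pmul (tl Q) R) n + coeff (pmul (tl P) (pmul Q R)) n
      ≡⟨ cong (_+ coeff (pmul (tl P) (pmul Q R)) n) (sym (*-distribˡ-+ (hd P) (hd Q * r) _)) ⟩
    hd P * (hd Q * r + coeff (pmul (tl Q) R) n) + coeff (pmul (tl P) (pmul Q R)) n
      ≡⟨ cong (λ z → hd P * z + coeff (pmul (tl P) (pmul Q R)) n) (sym (coeff-pmul-suc Q R n)) ⟩
    hd P * coeff (pmul Q R) (suc n) + coeff (pmul (tl P) (pmul Q R)) n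
      ≡⟨ sym (coeff-pmul-suc P (pmul Q R) n) ⟩
    coeff (pmul P (pmul Q R)) (suc n)
      ∎
    where r = coeff R (suc n)

  pmul-identityˡ : ∀ Q → pmul (1 ∷ []) Q ≋ Q
  pmul-identityˡ Q n = begin
    coeff (padd (pscale 1 Q) (0 ∷ [])) n         ≡⟨ coeff-padd (pscale 1 Q) (0 ∷ []) n ⟩
    coeff (pscale 1 Q) n + coeff (0 ∷ []) n      ≡⟨ cong₂ _+_ (coeff-pscale 1 Q n) (coeff-0∷[] n) ⟩
    1 * coeff Q n + 0                            ≡⟨ trans (+-identityʳ _) (*-identityˡ _) ⟩
    coeff Q n                                    ∎
    where
    coeff-0∷[] : ∀ n → coeff (0 ∷ []) n ≡ 0
    coeff-0∷[] zero    = refl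
    coeff-0∷[] (suc n) = refl

module PolynomialRing (p : ℕ) .{{_ : NonZero p}} where

  open Coefficientwise

  %-cong-+ : ∀ {a a' b b'} → a % p ≡ a' % p → b % p ≡ b' % p → (a + b) % p ≡ (a' + b') % p
  %-cong-+ {a} {a'} {b} {b'} e e' =
    trans (%-distribˡ-+ a b p) (trans (cong₂ (λ u v → (u + v) % p) e e') (sym (%-distribˡ-+ a' b' p)))

  %-cong-* : ∀ {a a' b b'} → a % p ≡ a' % p → b % p ≡ b' % p → (a * b) % p ≡ (a' * b') % p
  %-cong-* {a} {a'} {b} {b'} e e' =
    trans (%-distribˡ-* a b p) (trans (cong₂ (λ u v → (u * v) % p) e e') (sym (%-distribˡ-* a' b' p)))

  0%p≡0 : 0 % p ≡ 0
  0%p≡0 = m*n%n≡0 0 p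

  m%p≡0⇒[m+n]%p≡n%p : ∀ {m n} → m % p ≡ 0 → (m + n) % p ≡ n % p
  m%p≡0⇒[m+n]%p≡n%p {m} {n} e = %-cong-+ {m} {0} {n} {n} (trans e (sym 0%p≡0)) refl

  n%p≡0⇒[m+n]%p≡m%p : ∀ {m n} → n % p ≡ 0 → (m + n) % p ≡ m % p
  n%p≡0⇒[m+n]%p≡m%p {m} {n} e = trans (cong (_% p) (+-comm m n)) (m%p≡0⇒[m+n]%p≡n%p {n} {m} e)

  m%p≡0⇒[m*n]%p≡0 : ∀ {m n} → m % p ≡ 0 → (m * n) % p ≡ 0
  m%p≡0⇒[m*n]%p≡0 {m} {n} e = trans (%-cong-* {m} {0} {n} {n} (trans e (sym 0%p≡0)) refl) 0%p≡0

  n%p≡0⇒[m*n]%p≡0 : ∀ {m n} → n % p ≡ 0 → (m * n) % p ≡ 0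
  n%p≡0⇒[m*n]%p≡0 {m} {n} e = trans (cong (_% p) (*-comm m n)) (m%p≡0⇒[m*n]%p≡0 {n} {m} e)

  p∸1+1≡p : (p ∸ 1) + 1 ≡ p
  p∸1+1≡p = m∸n+n≡m (>-nonZero⁻¹ p)

  suc[p∸1]≡p : suc (p ∸ 1) ≡ p
  suc[p∸1]≡p = trans (+-comm 1 (p ∸ 1)) p∸1+1≡p

  -- A record rather than PolyEq itself, so that P and Q can be recovered from a proof of P ≈ Q.
  infix 4 _≈_
  record _≈_ (P Q : Poly) : Set where
    constructor ⟨_⟩
    field ≈-coeff : PolyEq p P Q
  open _≈_ public

  ≋⇒≈ : ∀ {P Q} → P ≋ Q → P ≈ Q
  ≋⇒≈ e = ⟨ (λ n → cong (_% p) (e n)) ⟩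

  ≈-refl : ∀ {P} → P ≈ P
  ≈-refl = ⟨ (λ n → refl) ⟩

  ≈-sym : ∀ {P Q} → P ≈ Q → Q ≈ P
  ≈-sym e = ⟨ (λ n → sym (≈-coeff e n)) ⟩

  ≈-trans : ∀ {P Q R} → P ≈ Q → Q ≈ R → P ≈ R
  ≈-trans e e' = ⟨ (λ n → trans (≈-coeff e n) (≈-coeff e' n)) ⟩

  neg : Poly → Poly
  neg []       = []
  neg (a ∷ as) = (p ∸ 1) * a ∷ neg as

  coeff-neg : ∀ P n → coeff (neg P) n ≡ (p ∸ 1) * coeff P n
  coeff-neg []      n       = sym (*-zeroʳ (p ∸ 1))
  coeff-neg (a ∷ P) zero    = refl
  coeff-neg (a ∷ P) (suc n) = coeff-neg P n

  padd-cong : ∀ {P P' Q Q'} → P ≈ P' → Q ≈ Q' → padd P Q ≈ padd P' Q'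
  padd-cong {P} {P'} {Q} {Q'} e e' = ⟨ (λ n →
    trans (cong (_% p) (coeff-padd P Q n))
      (trans (%-cong-+ (≈-coeff e n) (≈-coeff e' n)) (sym (cong (_% p) (coeff-padd P' Q' n))))) ⟩

  neg-cong : ∀ {P P'} → P ≈ P' → neg P ≈ neg P'
  neg-cong {P} {P'} e = ⟨ (λ n →
    trans (cong (_% p) (coeff-neg P n))
      (trans (%-cong-* {p ∸ 1} {p ∸ 1} refl (≈-coeff e n)) (sym (cong (_% p) (coeff-neg P' n))))) ⟩

  pmul-congˡ-≈ : ∀ {P P'} Q → P ≈ P' → pmul P Q ≈ pmul P' Q
  pmul-congˡ-≈ {P} {P'} Q e = ⟨ go P P' (≈-coeff e) ⟩
    where
    hd-% : ∀ P P' → PolyEq p P P' → hd P % p ≡ hd P' % p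
    hd-% P P' e = trans (cong (_% p) (sym (coeff-zero P))) (trans (e 0) (cong (_% p) (coeff-zero P')))
    tl-% : ∀ P P' → PolyEq p P P' → PolyEq p (tl P) (tl P')
    tl-% P P' e k = trans (cong (_% p) (sym (coeff-suc P k))) (trans (e (suc k)) (cong (_% p) (coeff-suc P' k)))
    go : ∀ P P' → PolyEq p P P' → PolyEq p (pmul P Q) (pmul P' Q)
    go P P' e zero = trans (cong (_% p) (coeff-pmul-zero P Q))
      (trans (%-cong-* {hd P} {hd P'} {hd Q} (hd-% P P' e) refl) (sym (cong (_% p) (coeff-pmul-zero P' Q))))
    go P P' e (suc n) = trans (cong (_% p) (coeff-pmul-suc P Q n))
      (trans (%-cong-+ (%-cong-* {hd P} {hd P'} {coeff Q (suc n)} (hd-% P P' e) refl) (go (tl P) (tl P') (tl-% P P' e) n))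
             (sym (cong (_% p) (coeff-pmul-suc P' Q n))))

  pmul-comm-≈ : ∀ P Q → pmul P Q ≈ pmul Q P
  pmul-comm-≈ P Q = ≋⇒≈ (pmul-comm P Q)

  pmul-congʳ-≈ : ∀ P {Q Q'} → Q ≈ Q' → pmul P Q ≈ pmul P Q'
  pmul-congʳ-≈ P {Q} {Q'} e = ≈-trans (pmul-comm-≈ P Q) (≈-trans (pmul-congˡ-≈ P e) (pmul-comm-≈ Q' P))

  pmul-cong : ∀ {P P' Q Q'} → P ≈ P' → Q ≈ Q' → pmul P Q ≈ pmul P' Q'
  pmul-cong {P} {P'} {Q} {Q'} e e' = ≈-trans (pmul-congˡ-≈ Q e) (pmul-congʳ-≈ P' e')

  padd-assoc : ∀ P Q R → padd (padd P Q) R ≈ padd P (padd Q R)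
  padd-assoc P Q R = ≋⇒≈ (λ n → begin
    coeff (padd (padd P Q) R) n            ≡⟨ coeff-padd (padd P Q) R n ⟩
    coeff (padd P Q) n + coeff R n         ≡⟨ cong (_+ coeff R n) (coeff-padd P Q n) ⟩
    coeff P n + coeff Q n + coeff R n      ≡⟨ +-assoc (coeff P n) (coeff Q n) (coeff R n) ⟩
    coeff P n + (coeff Q n + coeff R n)    ≡⟨ cong (coeff P n +_) (sym (coeff-padd Q R n)) ⟩
    coeff P n + coeff (padd Q R) n         ≡⟨ sym (coeff-padd P (padd Q R) n) ⟩
    coeff (padd P (padd Q R)) n            ∎)
    where open ≡-Reasoning

  padd-comm : ∀ P Q → padd P Q ≈ padd Q P
  padd-comm P Q = ≋⇒≈ (λ n →
    trans (coeff-padd P Q n) (trans (+-comm (coeff P n) (coeff Q n)) (sym (coeff-padd Q P n))))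

  padd-identityʳ : ∀ P → padd P [] ≈ P
  padd-identityʳ P = ≋⇒≈ (λ n → trans (coeff-padd P [] n) (+-identityʳ _))

  neg-inverseˡ : ∀ P → padd (neg P) P ≈ []
  neg-inverseˡ P = ⟨ (λ n → begin
    coeff (padd (neg P) P) n % p                ≡⟨ cong (_% p) (coeff-padd (neg P) P n) ⟩
    (coeff (neg P) n + coeff P n) % p           ≡⟨ cong (λ z → (z + coeff P n) % p) (coeff-neg P n) ⟩
    ((p ∸ 1) * coeff P n + coeff P n) % p       ≡⟨ cong (_% p) (multiple n) ⟩
    (coeff P n * p) % p                         ≡⟨ m*n%n≡0 (coeff P n) p ⟩
    0                                           ≡⟨ sym 0%p≡0 ⟩
    0 % p                                       ∎) ⟩
    where
    open ≡-Reasoning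
    multiple : ∀ n → (p ∸ 1) * coeff P n + coeff P n ≡ coeff P n * p
    multiple n = begin
      (p ∸ 1) * coeff P n + coeff P n        ≡⟨ cong ((p ∸ 1) * coeff P n +_) (sym (*-identityˡ (coeff P n))) ⟩
      (p ∸ 1) * coeff P n + 1 * coeff P n    ≡⟨ sym (*-distribʳ-+ (coeff P n) (p ∸ 1) 1) ⟩
      ((p ∸ 1) + 1) * coeff P n              ≡⟨ cong (_* coeff P n) p∸1+1≡p ⟩
      p * coeff P n                          ≡⟨ *-comm p (coeff P n) ⟩
      coeff P n * p                          ∎

  pmul-distribˡ-≈ : ∀ Q P P' → pmul Q (padd P P') ≈ padd (pmul Q P) (pmul Q P')
  pmul-distribˡ-≈ Q P P' = ≈-trans (pmul-comm-≈ Q (padd P P'))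
    (≈-trans (≋⇒≈ (pmul-distribʳ P P' Q)) (padd-cong (pmul-comm-≈ P Q) (pmul-comm-≈ P' Q)))

  isCommutativeRing : IsCommutativeRing _≈_ padd pmul neg [] (1 ∷ [])
  isCommutativeRing = record
    { isRing = record
      { +-isAbelianGroup = record
        { isGroup = record
          { isMonoid = record
            { isSemigroup = record
              { isMagma = record
                { isEquivalence = record { refl = ≈-refl ; sym = ≈-sym ; trans = ≈-trans }
                ; ∙-cong = padd-cong }
              ; assoc = padd-assoc }
            ; identity = (λ P → ≈-refl) , padd-identityʳ }
          ; inverse = neg-inverseˡ , (λ P → ≈-trans (padd-comm P (neg P)) (neg-inverseˡ P))
          ; ⁻¹-cong = neg-cong }
        ; comm = padd-comm }
      ; *-cong = pmul-cong
      ; *-assoc = λ P Q R → ≋⇒≈ (pmul-assoc P Q R)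
      ; *-identity = (λ P → ≋⇒≈ (pmul-identityˡ P))
                   , (λ P → ≈-trans (pmul-comm-≈ P (1 ∷ [])) (≋⇒≈ (pmul-identityˡ P)))
      ; distrib = pmul-distribˡ-≈ , (λ Q P P' → ≋⇒≈ (pmul-distribʳ P P' Q)) }
    ; *-comm = pmul-comm-≈ }

  Fp[x] : CommutativeRing _ _
  Fp[x] = record { isCommutativeRing = isCommutativeRing }

  open import Algebra.Solver.Ring.NaturalCoefficients.Default (CommutativeRing.commutativeSemiring Fp[x]) public
  module ≈-Reasoning = SetoidReasoning (CommutativeRing.setoid Fp[x])

  infixl 6 _⊕_
  infixl 7 _⊗_
  _⊕_ _⊗_ : Poly → Poly → Poly
  _⊕_ = padd
  _⊗_ = pmul

  𝟘 𝟙 X : Poly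
  𝟘 = []
  𝟙 = 1 ∷ []
  X = 0 ∷ 1 ∷ []

  κ : ℕ → Poly
  κ c = c ∷ []

  κ-mod : ∀ {a b} → a % p ≡ b % p → κ a ≈ κ b
  κ-mod e = ⟨ (λ { zero → e ; (suc n) → refl }) ⟩

  κ-* : ∀ a b → κ (a * b) ≈ κ a ⊗ κ b
  κ-* a b = ≋⇒≈ (λ { zero → sym (+-identityʳ (a * b)) ; (suc n) → refl })

  κ-suc : ∀ n → κ (suc n) ≈ κ n ⊕ 𝟙
  κ-suc n = ≋⇒≈ (λ { zero → +-comm 1 n ; (suc k) → refl })

  κ0≈𝟘 : κ 0 ≈ 𝟘
  κ0≈𝟘 = ⟨ (λ { zero → refl ; (suc n) → refl }) ⟩

  κp≈𝟘 : κ p ≈ 𝟘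
  κp≈𝟘 = ⟨ (λ { zero → trans (n%n≡0 p) (sym 0%p≡0) ; (suc n) → refl }) ⟩

  ⊗-zeroʳ : ∀ P → P ⊗ 𝟘 ≈ 𝟘
  ⊗-zeroʳ P = pmul-comm-≈ P 𝟘

  ⊗-identityˡ : ∀ P → 𝟙 ⊗ P ≈ P
  ⊗-identityˡ P = ≋⇒≈ (pmul-identityˡ P)

  0∷≈X⊗ : ∀ R → (0 ∷ R) ≈ X ⊗ R
  0∷≈X⊗ R = ≋⇒≈ (λ n → sym (trans (coeff-padd (pscale 0 R) (0 ∷ pmul 𝟙 R) n)
                                  (trans (cong (_+ coeff (0 ∷ pmul 𝟙 R) n) (coeff-pscale 0 R n)) (lemma n))))
    where
    lemma : ∀ n → coeff (0 ∷ pmul 𝟙 R) n ≡ coeff (0 ∷ R) n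
    lemma zero    = refl
    lemma (suc n) = pmul-identityˡ R n

  ppow : Poly → ℕ → Poly
  ppow P zero    = 𝟙
  ppow P (suc n) = ppow P n ⊗ P

  D : Poly → Poly
  D = pderiv

  coeff-pderivFrom : ∀ k P n → coeff (pderivFrom k P) n ≡ (k + n) * coeff P n
  coeff-pderivFrom k []      n       = sym (*-zeroʳ (k + n))
  coeff-pderivFrom k (a ∷ P) zero    = cong (_* a) (sym (+-identityʳ k))
  coeff-pderivFrom k (a ∷ P) (suc n) = trans (coeff-pderivFrom (suc k) P n) (cong (_* coeff P n) (sym (+-suc k n)))

  coeff-D : ∀ P n → coeff (D P) n ≡ suc n * coeff P (suc n)
  coeff-D []      n = sym (*-zeroʳ (suc n))
  coeff-D (a ∷ P) n = coeff-pderivFrom 1 P n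

  D-cong : ∀ {P Q} → P ≈ Q → D P ≈ D Q
  D-cong {P} {Q} e = ⟨ (λ n → trans (cong (_% p) (coeff-D P n))
    (trans (%-cong-* {suc n} {suc n} refl (≈-coeff e (suc n))) (sym (cong (_% p) (coeff-D Q n))))) ⟩

  D-⊕ : ∀ P Q → D (P ⊕ Q) ≈ D P ⊕ D Q
  D-⊕ P Q = ≋⇒≈ (λ n → begin
    coeff (D (padd P Q)) n                                  ≡⟨ coeff-D (padd P Q) n ⟩
    suc n * coeff (padd P Q) (suc n)                        ≡⟨ cong (suc n *_) (coeff-padd P Q (suc n)) ⟩
    suc n * (coeff P (suc n) + coeff Q (suc n))             ≡⟨ *-distribˡ-+ (suc n) (coeff P (suc n)) (coeff Q (suc n)) ⟩
    suc n * coeff P (suc n) + suc n * coeff Q (suc n)       ≡⟨ sym (cong₂ _+_ (coeff-D P n) (coeff-D Q n)) ⟩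
    coeff (D P) n + coeff (D Q) n                           ≡⟨ sym (coeff-padd (D P) (D Q) n) ⟩
    coeff (padd (D P) (D Q)) n                              ∎)
    where open ≡-Reasoning

  D-pscale : ∀ c P → D (pscale c P) ≈ pscale c (D P)
  D-pscale c P = ≋⇒≈ (λ n → begin
    coeff (D (pscale c P)) n             ≡⟨ coeff-D (pscale c P) n ⟩
    suc n * coeff (pscale c P) (suc n)   ≡⟨ cong (suc n *_) (coeff-pscale c P (suc n)) ⟩
    suc n * (c * coeff P (suc n))        ≡⟨ *-exchange (suc n) c (coeff P (suc n)) ⟩
    c * (suc n * coeff P (suc n))        ≡⟨ cong (c *_) (sym (coeff-D P n)) ⟩
    c * coeff (D P) n                    ≡⟨ sym (coeff-pscale c (D P) n) ⟩
    coeff (pscale c (D P)) n             ∎)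
    where
    open ≡-Reasoning
    *-exchange : ∀ a b c → a * (b * c) ≡ b * (a * c)
    *-exchange = solve-∀
      where open import Data.Nat.Tactic.RingSolver

  D-0∷ : ∀ R → D (0 ∷ R) ≈ R ⊕ X ⊗ D R
  D-0∷ R = ≈-trans (≋⇒≈ lemma) (padd-cong {R} ≈-refl (0∷≈X⊗ (D R)))
    where
    lemma : ∀ n → coeff (D (0 ∷ R)) n ≡ coeff (padd R (0 ∷ D R)) n
    lemma zero    = trans (coeff-D (0 ∷ R) 0) (trans (+-identityʳ _) (sym (trans (coeff-padd R (0 ∷ D R) 0) (+-identityʳ _))))
    lemma (suc n) = trans (coeff-D (0 ∷ R) (suc n)) (sym (trans (coeff-padd R (0 ∷ D R) (suc n)) (cong (coeff R (suc n) +_) (coeff-D R n))))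

  D-∷ : ∀ a R → D (a ∷ R) ≈ R ⊕ X ⊗ D R
  D-∷ a R = ≈-trans (≋⇒≈ (λ n → trans (coeff-D (a ∷ R) n) (sym (coeff-D (0 ∷ R) n)))) (D-0∷ R)

  leibniz : ∀ P Q → D (P ⊗ Q) ≈ D P ⊗ Q ⊕ P ⊗ D Q
  leibniz []       Q = ≈-refl
  leibniz (a ∷ as) Q = begin
    D (pscale a Q ⊕ (0 ∷ as ⊗ Q))
      ≈⟨ D-⊕ (pscale a Q) (0 ∷ as ⊗ Q) ⟩
    D (pscale a Q) ⊕ D (0 ∷ as ⊗ Q)
      ≈⟨ padd-cong (D-pscale a Q) (≈-trans (D-0∷ (as ⊗ Q)) (padd-cong {as ⊗ Q} ≈-refl (pmul-congʳ-≈ X (leibniz as Q)))) ⟩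
    pscale a (D Q) ⊕ (as ⊗ Q ⊕ X ⊗ (D as ⊗ Q ⊕ as ⊗ D Q))
      ≈⟨ solve 6 (λ S as Q Xv Das DQ → S :+ (as :* Q :+ Xv :* (Das :* Q :+ as :* DQ))
                                        := (as :+ Xv :* Das) :* Q :+ (S :+ Xv :* (as :* DQ)))
                 ≈-refl (pscale a (D Q)) as Q X (D as) (D Q) ⟩
    (as ⊕ X ⊗ D as) ⊗ Q ⊕ (pscale a (D Q) ⊕ X ⊗ (as ⊗ D Q))
      ≈⟨ padd-cong (pmul-congˡ-≈ Q (≈-sym (D-∷ a as))) (padd-cong {pscale a (D Q)} ≈-refl (≈-sym (0∷≈X⊗ (as ⊗ D Q)))) ⟩
    D (a ∷ as) ⊗ Q ⊕ (a ∷ as) ⊗ D Q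
      ∎
    where open ≈-Reasoning

  D-ppow : ∀ P n → D (ppow P (suc n)) ≈ κ (suc n) ⊗ ppow P n ⊗ D P
  D-ppow P zero = begin
    D (𝟙 ⊗ P)            ≈⟨ D-cong {𝟙 ⊗ P} {P} (⊗-identityˡ P) ⟩
    D P                  ≈⟨ solve 1 (λ DP → DP := con 1 :* con 1 :* DP) ≈-refl (D P) ⟩
    κ 1 ⊗ 𝟙 ⊗ D P       ∎
    where open ≈-Reasoning
  D-ppow P (suc n) = begin
    D (ppow P (suc n) ⊗ P)
      ≈⟨ leibniz (ppow P (suc n)) P ⟩
    D (ppow P (suc n)) ⊗ P ⊕ ppow P (suc n) ⊗ D P
      ≈⟨ padd-cong (pmul-congˡ-≈ P (D-ppow P n)) ≈-refl ⟩
    (κ (suc n) ⊗ ppow P n ⊗ D P) ⊗ P ⊕ (ppow P n ⊗ P) ⊗ D P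
      ≈⟨ solve 4 (λ k A P DP → (k :* A :* DP) :* P :+ (A :* P) :* DP := (k :+ con 1) :* (A :* P) :* DP)
                 ≈-refl (κ (suc n)) (ppow P n) P (D P) ⟩
    (κ (suc n) ⊕ 𝟙) ⊗ ppow P (suc n) ⊗ D P
      ≈⟨ pmul-congˡ-≈ (D P) (pmul-congˡ-≈ (ppow P (suc n)) (≈-sym (κ-suc (suc n)))) ⟩
    κ (suc (suc n)) ⊗ ppow P (suc n) ⊗ D P
      ∎
    where open ≈-Reasoning

  D-xpow : ∀ k → D (xpow (suc k)) ≈ κ (suc k) ⊗ xpow k
  D-xpow zero    = ≋⇒≈ (λ { zero → refl ; (suc n) → refl })
  D-xpow (suc k) = begin
    D (0 ∷ xpow (suc k))                         ≈⟨ D-0∷ (xpow (suc k)) ⟩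
    xpow (suc k) ⊕ X ⊗ D (xpow (suc k))         ≈⟨ padd-cong {xpow (suc k)} ≈-refl (pmul-congʳ-≈ X (D-xpow k)) ⟩
    xpow (suc k) ⊕ X ⊗ (κ (suc k) ⊗ xpow k)     ≈⟨ padd-cong (0∷≈X⊗ (xpow k)) ≈-refl ⟩
    X ⊗ xpow k ⊕ X ⊗ (κ (suc k) ⊗ xpow k)       ≈⟨ solve 3 (λ x c B → x :* B :+ x :* (c :* B) := (c :+ con 1) :* (x :* B))
                                                           ≈-refl X (κ (suc k)) (xpow k) ⟩
    (κ (suc k) ⊕ 𝟙) ⊗ (X ⊗ xpow k)              ≈⟨ pmul-cong (≈-sym (κ-suc (suc k))) (≈-sym (0∷≈X⊗ (xpow k))) ⟩
    κ (suc (suc k)) ⊗ xpow (suc k)               ∎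
    where open ≈-Reasoning

  VanishesFrom : Poly → ℕ → Set
  VanishesFrom P k = ∀ n → k ≤ n → coeff P n % p ≡ 0

  IsZero : Poly → Set
  IsZero P = VanishesFrom P 0

  IsZero⇒≈𝟘 : ∀ {P} → IsZero P → P ≈ 𝟘
  IsZero⇒≈𝟘 v = ⟨ (λ n → trans (v n z≤n) (sym 0%p≡0)) ⟩

  ≈𝟘⇒IsZero : ∀ {P} → P ≈ 𝟘 → IsZero P
  ≈𝟘⇒IsZero e n _ = trans (≈-coeff e n) 0%p≡0

  ¬IsZero-𝟙 : 1 < p → ¬ IsZero 𝟙
  ¬IsZero-𝟙 1<p v = 0≢1+n (trans (sym (v 0 z≤n)) (m<n⇒m%n≡m 1<p))

  vanishesFrom-tl : ∀ P k → VanishesFrom P (suc k) → VanishesFrom (tl P) k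
  vanishesFrom-tl P k v n k≤n = trans (cong (_% p) (sym (coeff-suc P n))) (v (suc n) (s≤s k≤n))

  vanishesFrom-mono : ∀ P {k k'} → k ≤ k' → VanishesFrom P k → VanishesFrom P k'
  vanishesFrom-mono P k≤k' v n k'≤n = v n (≤-trans k≤k' k'≤n)

  vanishesFrom-cong : ∀ {P Q} k → P ≈ Q → VanishesFrom P k → VanishesFrom Q k
  vanishesFrom-cong k e v n k≤n = trans (sym (≈-coeff e n)) (v n k≤n)

  vanishesFrom-D : ∀ P k → VanishesFrom P (suc k) → VanishesFrom (D P) k
  vanishesFrom-D P k v n k≤n = trans (cong (_% p) (coeff-D P n)) (n%p≡0⇒[m*n]%p≡0 {suc n} (v (suc n) (s≤s k≤n)))

  coeff-⊗-IsZeroˡ : ∀ P G n → IsZero P → coeff (P ⊗ G) n % p ≡ 0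
  coeff-⊗-IsZeroˡ P G n v = trans (≈-coeff (pmul-congˡ-≈ G (IsZero⇒≈𝟘 {P} v)) n) 0%p≡0

  vanishesFrom-⊗ : ∀ i P Q k → VanishesFrom P (suc i) → VanishesFrom Q k → VanishesFrom (P ⊗ Q) (i + k)
  vanishesFrom-⊗ zero P Q zero vP vQ zero _ = trans (cong (_% p) (coeff-pmul-zero P Q))
    (n%p≡0⇒[m*n]%p≡0 {hd P} (trans (cong (_% p) (sym (coeff-zero Q))) (vQ 0 z≤n)))
  vanishesFrom-⊗ zero P Q k vP vQ (suc n) k≤n = trans (cong (_% p) (coeff-pmul-suc P Q n))
    (trans (m%p≡0⇒[m+n]%p≡n%p {hd P * coeff Q (suc n)} (n%p≡0⇒[m*n]%p≡0 {hd P} (vQ (suc n) k≤n)))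
           (coeff-⊗-IsZeroˡ (tl P) Q n (vanishesFrom-tl P 0 vP)))
  vanishesFrom-⊗ (suc i) P Q k vP vQ (suc n) (s≤s i+k≤n) = trans (cong (_% p) (coeff-pmul-suc P Q n))
    (trans (m%p≡0⇒[m+n]%p≡n%p {hd P * coeff Q (suc n)} (n%p≡0⇒[m*n]%p≡0 {hd P} (vQ (suc n) k≤1+n)))
           (vanishesFrom-⊗ i (tl P) Q k (vanishesFrom-tl P (suc i) vP) vQ n i+k≤n))
    where
    k≤1+n : k ≤ suc n
    k≤1+n = ≤-trans (m≤n+m k i) (m≤n⇒m≤1+n i+k≤n)

  -- Every other term Z_b G_(e+j-b) has b inside the gap or e + j - b ≥ j + L.
  coeff-⊗-isolated : ∀ e L j Z G → VanishesFrom Z (suc e) →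
    (∀ b → b < e → e ∸ b < L → coeff Z b % p ≡ 0) → VanishesFrom G (j + L) →
    coeff (Z ⊗ G) (e + j) % p ≡ (coeff Z e * coeff G j) % p
  coeff-⊗-isolated zero L zero Z G vZ gap vG =
    cong (_% p) (trans (coeff-pmul-zero Z G) (sym (cong₂ _*_ (coeff-zero Z) (coeff-zero G))))
  coeff-⊗-isolated zero L (suc j) Z G vZ gap vG = trans (cong (_% p) (coeff-pmul-suc Z G j))
    (trans (n%p≡0⇒[m+n]%p≡m%p {hd Z * coeff G (suc j)} (coeff-⊗-IsZeroˡ (tl Z) G j (vanishesFrom-tl Z 0 vZ)))
           (cong (λ z → (z * coeff G (suc j)) % p) (sym (coeff-zero Z))))
  coeff-⊗-isolated (suc e) L j Z G vZ gap vG = trans (cong (_% p) (coeff-pmul-suc Z G (e + j)))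
    (trans (m%p≡0⇒[m+n]%p≡n%p {hd Z * coeff G (suc (e + j))} constant-term)
      (trans (coeff-⊗-isolated e L j (tl Z) G (vanishesFrom-tl Z (suc e) vZ) gap-tl vG)
             (cong (λ z → (z * coeff G j) % p) (sym (coeff-suc Z e)))))
    where
    gap-tl : ∀ b → b < e → e ∸ b < L → coeff (tl Z) b % p ≡ 0
    gap-tl b b<e e∸b<L = trans (cong (_% p) (sym (coeff-suc Z b))) (gap (suc b) (s≤s b<e) e∸b<L)
    constant-term : (hd Z * coeff G (suc (e + j))) % p ≡ 0
    constant-term with suc e <? L
    ... | yes 1+e<L = m%p≡0⇒[m*n]%p≡0 {hd Z} (trans (cong (_% p) (sym (coeff-zero Z))) (gap 0 (s≤s z≤n) 1+e<L))
    ... | no 1+e≮L  = n%p≡0⇒[m*n]%p≡0 {hd Z} (vG (suc (e + j))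
                        (≤-trans (≤-reflexive (+-comm j L)) (+-monoˡ-≤ j (≮⇒≥ 1+e≮L))))

  IsZero? : ∀ P → Dec (IsZero P)
  IsZero? []       = yes (λ n _ → 0%p≡0)
  IsZero? (a ∷ as) with a % p ≟ 0 | IsZero? as
  ... | no a≢0  | _        = no (λ v → a≢0 (v 0 z≤n))
  ... | yes a≡0 | yes v    = yes (λ { zero _ → a≡0 ; (suc n) _ → v n z≤n })
  ... | yes a≡0 | no ¬v    = no (λ v → ¬v (λ n _ → v (suc n) z≤n))

  degree : ∀ P → ¬ IsZero P → Σ ℕ λ e → (coeff P e % p ≢ 0) × VanishesFrom P (suc e)
  degree []       P≢0 = ⊥-elim (P≢0 (λ n _ → 0%p≡0))
  degree (a ∷ as) P≢0 with IsZero? as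
  ... | yes v  = 0 , (λ a≡0 → P≢0 (λ { zero _ → a≡0 ; (suc n) _ → v n z≤n })) , (λ { (suc n) _ → v n z≤n })
  ... | no ¬v with degree as ¬v
  ...   | e , lead , v = suc e , lead , (λ { (suc n) (s≤s e<n) → v n e<n })

  D-⊗-constant : ∀ A B → D A ≈ 𝟘 → D B ≈ 𝟘 → D (A ⊗ B) ≈ 𝟘
  D-⊗-constant A B dA dB = ≈-trans (leibniz A B)
    (padd-cong (pmul-congˡ-≈ B dA) (≈-trans (pmul-congʳ-≈ A dB) (⊗-zeroʳ A)))

  D-xpow-p≈𝟘 : D (xpow p) ≈ 𝟘
  D-xpow-p≈𝟘 = ≈-trans (subst (λ q → D (xpow q) ≈ κ q ⊗ xpow (p ∸ 1)) (suc[p∸1]≡p) (D-xpow (p ∸ 1)))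
                       (pmul-congˡ-≈ (xpow (p ∸ 1)) κp≈𝟘)

  coeff-xpow-⊗-< : ∀ k Q n → n < k → coeff (xpow k ⊗ Q) n ≡ 0
  coeff-xpow-⊗-< (suc k) Q zero    _         = coeff-pmul-zero (xpow (suc k)) Q
  coeff-xpow-⊗-< (suc k) Q (suc n) (s≤s n<k) = trans (coeff-pmul-suc (xpow (suc k)) Q n) (coeff-xpow-⊗-< k Q n n<k)

  coeff-xpow-⊗-+ : ∀ k Q j → coeff (xpow k ⊗ Q) (k + j) ≡ coeff Q j
  coeff-xpow-⊗-+ zero    Q j = pmul-identityˡ Q j
  coeff-xpow-⊗-+ (suc k) Q j = trans (coeff-pmul-suc (xpow (suc k)) Q (k + j)) (coeff-xpow-⊗-+ k Q j)

  coeff-take-< : ∀ k P n → n < k → coeff (take k P) n ≡ coeff P n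
  coeff-take-< (suc k) []      n       _         = refl
  coeff-take-< (suc k) (a ∷ P) zero    _         = refl
  coeff-take-< (suc k) (a ∷ P) (suc n) (s≤s n<k) = coeff-take-< k P n n<k

  coeff-take-≥ : ∀ k P n → k ≤ n → coeff (take k P) n ≡ 0
  coeff-take-≥ zero    P       n       _         = refl
  coeff-take-≥ (suc k) []      n       _         = refl
  coeff-take-≥ (suc k) (a ∷ P) (suc n) (s≤s k≤n) = coeff-take-≥ k P n k≤n

  coeff-drop : ∀ k P n → coeff (drop k P) n ≡ coeff P (k + n)
  coeff-drop zero    P       n = refl
  coeff-drop (suc k) []      n = refl
  coeff-drop (suc k) (a ∷ P) n = coeff-drop k P n

  take⊕xpow⊗drop : ∀ k P → P ≈ take k P ⊕ xpow k ⊗ drop k P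
  take⊕xpow⊗drop k P = ≋⇒≈ (go k P)
    where
    go : ∀ k P → P ≋ take k P ⊕ xpow k ⊗ drop k P
    go zero    P       n       = sym (pmul-identityˡ P n)
    go (suc k) []      n       = sym (pmul-comm (xpow (suc k)) [] n)
    go (suc k) (a ∷ P) zero    = sym (trans (coeff-padd (a ∷ take k P) (xpow (suc k) ⊗ drop k P) 0)
                                            (trans (cong (a +_) (coeff-pmul-zero (xpow (suc k)) (drop k P)))
                                                   (+-identityʳ a)))
    go (suc k) (a ∷ P) (suc n) = trans (go k P n) (sym (trans (coeff-padd (a ∷ take k P) (xpow (suc k) ⊗ drop k P) (suc n))
                                   (trans (cong (coeff (take k P) n +_) (coeff-pmul-suc (xpow (suc k)) (drop k P) n))
                                          (sym (coeff-padd (take k P) (xpow k ⊗ drop k P) n)))))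

  ⊕xpow⊗-injective : ∀ k A B C E → VanishesFrom A k → VanishesFrom C k →
    A ⊕ xpow k ⊗ B ≈ C ⊕ xpow k ⊗ E → (A ≈ C) × (B ≈ E)
  ⊕xpow⊗-injective k A B C E vA vC e = ⟨ low ⟩ , ⟨ high ⟩
    where
    below : ∀ A B n → n < k → coeff (A ⊕ xpow k ⊗ B) n ≡ coeff A n
    below A B n n<k = trans (coeff-padd A (xpow k ⊗ B) n) (trans (cong (coeff A n +_) (coeff-xpow-⊗-< k B n n<k)) (+-identityʳ _))
    above : ∀ A B n → VanishesFrom A k → coeff (A ⊕ xpow k ⊗ B) (k + n) % p ≡ coeff B n % p
    above A B n vA = trans (cong (_% p) (trans (coeff-padd A (xpow k ⊗ B) (k + n)) (cong (coeff A (k + n) +_) (coeff-xpow-⊗-+ k B n))))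
                           (m%p≡0⇒[m+n]%p≡n%p {coeff A (k + n)} (vA (k + n) (m≤m+n k n)))
    low : PolyEq p A C
    low n with k ≤? n
    ... | yes k≤n = trans (vA n k≤n) (sym (vC n k≤n))
    ... | no k≰n  = trans (cong (_% p) (sym (below A B n (≰⇒> k≰n))))
                          (trans (≈-coeff e n) (cong (_% p) (below C E n (≰⇒> k≰n))))
    high : PolyEq p B E
    high n = trans (sym (above A B n vA)) (trans (≈-coeff e (k + n)) (above C E n vC))

module PrimeField (p : ℕ) .{{_ : NonZero p}} (p-prime : Prime p) where

  open PolynomialRing p public
  open import Algebra.Properties.Ring (CommutativeRing.ring Fp[x]) using (x[y-z]≈xy-xz)
  open import Algebra.Properties.Group (CommutativeRing.+-group Fp[x]) using (∙-cancelʳ; x∙y⁻¹≈ε⇒x≈y; x≈y⇒x∙y⁻¹≈ε)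

  1<p : 1 < p
  1<p = nonTrivial⇒n>1 p {{prime⇒nonTrivial p-prime}}

  1%p≡1 : 1 % p ≡ 1
  1%p≡1 = m<n⇒m%n≡m 1<p

  m*n%p≡0⇒m%p≡0⊎n%p≡0 : ∀ m n → (m * n) % p ≡ 0 → m % p ≡ 0 ⊎ n % p ≡ 0
  m*n%p≡0⇒m%p≡0⊎n%p≡0 m n e with euclidsLemma m n p-prime (m%n≡0⇒n∣m (m * n) p e)
  ... | inj₁ p∣m = inj₁ (n∣m⇒m%n≡0 m p p∣m)
  ... | inj₂ p∣n = inj₂ (n∣m⇒m%n≡0 n p p∣n)

  %-inverse : ∀ c → c % p ≢ 0 → Σ ℕ λ c' → (c' * c) % p ≡ 1 % p
  %-inverse c c≢0 = from-Bézout (coprime-Bézout (prime⇒coprime p-prime {{r≢0}} (m%n<n c p)))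
    where
    r = c % p
    r≢0 : NonZero r
    r≢0 = ≢-nonZero c≢0
    lift : ∀ y → (r * y) % p ≡ 1 % p → (y * c) % p ≡ 1 % p
    lift y e = trans (cong (_% p) (*-comm y c)) (trans (%-cong-* {c} {r} {y} {y} (sym (m%n%n≡m%n c p)) refl) e)
    -- In the second case y r ≡ -1, so y (p - 1) is the inverse of r.
    negated : ∀ x y → 1 + y * r ≡ x * p → r * (y * (p ∸ 1)) + 1 * p ≡ 1 + x * (p ∸ 1) * p
    negated x y eq = begin
      r * (y * q) + 1 * p        ≡⟨ cong (λ z → r * (y * q) + 1 * z) (sym p∸1+1≡p) ⟩
      r * (y * q) + 1 * (q + 1)  ≡⟨ rearrange r y q ⟩
      (1 + y * r) * q + 1        ≡⟨ cong (λ z → z * q + 1) eq ⟩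
      x * p * q + 1              ≡⟨ rearrange′ x p q ⟩
      1 + x * q * p              ∎
      where
      open ≡-Reasoning
      open import Data.Nat.Tactic.RingSolver
      q = p ∸ 1
      rearrange : ∀ r y q → r * (y * q) + 1 * (q + 1) ≡ (1 + y * r) * q + 1
      rearrange = solve-∀
      rearrange′ : ∀ x p q → x * p * q + 1 ≡ 1 + x * q * p
      rearrange′ = solve-∀
    from-Bézout : Bézout.Identity 1 p r → Σ ℕ λ c' → (c' * c) % p ≡ 1 % p
    from-Bézout (Bézout.-+ x y eq) =
      y , lift y (trans (cong (_% p) (trans (*-comm r y) (sym eq))) ([m+kn]%n≡m%n 1 x p))
    from-Bézout (Bézout.+- x y eq) = y * (p ∸ 1) , lift (y * (p ∸ 1))
      (trans (sym ([m+kn]%n≡m%n (r * (y * (p ∸ 1))) 1 p))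
             (trans (cong (_% p) (negated x y eq)) ([m+kn]%n≡m%n 1 (x * (p ∸ 1)) p)))

  κ-invertible : ∀ c → c % p ≢ 0 → Σ ℕ λ c' → κ c' ⊗ κ c ≈ 𝟙
  κ-invertible c c≢0 with %-inverse c c≢0
  ... | c' , c'c≡1 = c' , ≈-trans (≈-sym (κ-* c' c)) (κ-mod c'c≡1)

  κ-invertible-< : ∀ n → suc n < p → Σ ℕ λ c' → κ c' ⊗ κ (suc n) ≈ 𝟙
  κ-invertible-< n 1+n<p = κ-invertible (suc n) (λ e → 0≢1+n (trans (sym e) (m<n⇒m%n≡m 1+n<p)))

  ¬IsZero-⊗ : ∀ P Q → ¬ IsZero P → ¬ IsZero Q → ¬ IsZero (P ⊗ Q)
  ¬IsZero-⊗ P Q P≢0 Q≢0 PQ≡0 with degree P P≢0 | degree Q Q≢0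
  ... | e , lead , vP | e' , lead' , vQ
    with m*n%p≡0⇒m%p≡0⊎n%p≡0 (coeff P e) (coeff Q e')
           (trans (sym (coeff-⊗-isolated e 1 e' P Q vP no-gap vQ′)) (PQ≡0 (e + e') z≤n))
    where
    no-gap : ∀ b → b < e → e ∸ b < 1 → coeff P b % p ≡ 0
    no-gap b b<e e∸b<1 = ⊥-elim (<⇒≱ e∸b<1 (m<n⇒0<n∸m b<e))
    vQ′ : VanishesFrom Q (e' + 1)
    vQ′ = vanishesFrom-mono Q (≤-reflexive (+-comm 1 e')) vQ
  ... | inj₁ z = lead z
  ... | inj₂ z = lead' z

  ¬IsZero-ppow : ∀ P → ¬ IsZero P → ∀ n → ¬ IsZero (ppow P n)
  ¬IsZero-ppow P P≢0 zero    = ¬IsZero-𝟙 1<p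
  ¬IsZero-ppow P P≢0 (suc n) = ¬IsZero-⊗ (ppow P n) P (¬IsZero-ppow P P≢0 n) P≢0

  ⊕-cancelʳ : ∀ A B C → A ⊕ C ≈ B ⊕ C → A ≈ B
  ⊕-cancelʳ A B C = ∙-cancelʳ C A B

  ⊗-cancelˡ : ∀ P A B → ¬ IsZero P → P ⊗ A ≈ P ⊗ B → A ≈ B
  ⊗-cancelˡ P A B P≢0 e with IsZero? (A ⊕ neg B)
  ... | yes A-B≡0 = x∙y⁻¹≈ε⇒x≈y A B (IsZero⇒≈𝟘 {A ⊕ neg B} A-B≡0)
  ... | no  A-B≢0 = ⊥-elim (¬IsZero-⊗ P (A ⊕ neg B) P≢0 A-B≢0 (≈𝟘⇒IsZero
          (≈-trans (x[y-z]≈xy-xz P A B) (x≈y⇒x∙y⁻¹≈ε e))))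

  D≈𝟘⇒coeff≡0 : ∀ P → D P ≈ 𝟘 → ∀ b → b % p ≢ 0 → coeff P b % p ≡ 0
  D≈𝟘⇒coeff≡0 P DP≈0 zero    b≢0 = ⊥-elim (b≢0 0%p≡0)
  D≈𝟘⇒coeff≡0 P DP≈0 (suc b) b≢0
    with m*n%p≡0⇒m%p≡0⊎n%p≡0 (suc b) (coeff P (suc b))
           (trans (sym (cong (_% p) (coeff-D P b))) (≈𝟘⇒IsZero {D P} DP≈0 b z≤n))
  ... | inj₁ z = ⊥-elim (b≢0 z)
  ... | inj₂ z = z

  Exact : Poly → Set
  Exact Z = Σ Poly λ Q → Z ≈ D Q

  Exact-cong : ∀ {Z Z'} → Z ≈ Z' → Exact Z → Exact Z'
  Exact-cong e (Q , Z≈DQ) = Q , ≈-trans (≈-sym e) Z≈DQ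

  Exact-𝟘 : Exact 𝟘
  Exact-𝟘 = 𝟘 , ≈-refl

  Exact-⊕ : ∀ {Z Z'} → Exact Z → Exact Z' → Exact (Z ⊕ Z')
  Exact-⊕ (Q , Z≈DQ) (Q' , Z'≈DQ') = Q ⊕ Q' , ≈-trans (padd-cong Z≈DQ Z'≈DQ') (≈-sym (D-⊕ Q Q'))

  Exact-⊗-constant : ∀ {Z} C → Exact Z → D C ≈ 𝟘 → Exact (Z ⊗ C)
  Exact-⊗-constant {Z} C (Q , Z≈DQ) DC≈0 = Q ⊗ C , (begin
    Z ⊗ C                 ≈⟨ pmul-congˡ-≈ C Z≈DQ ⟩
    D Q ⊗ C               ≈⟨ ≈-sym (padd-identityʳ (D Q ⊗ C)) ⟩
    D Q ⊗ C ⊕ 𝟘           ≈⟨ padd-cong {D Q ⊗ C} ≈-refl (≈-sym (≈-trans (pmul-congʳ-≈ Q DC≈0) (⊗-zeroʳ Q))) ⟩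
    D Q ⊗ C ⊕ Q ⊗ D C     ≈⟨ ≈-sym (leibniz Q C) ⟩
    D (Q ⊗ C)             ∎)
    where open ≈-Reasoning

  Exact-xpow-⊗-constant : ∀ n W → suc n < p → D W ≈ 𝟘 → Exact (xpow n ⊗ W)
  Exact-xpow-⊗-constant n W 1+n<p DW≈0 with κ-invertible-< n 1+n<p
  ... | c' , c'c≈1 = κ c' ⊗ (xpow (suc n) ⊗ W) , (begin
    xpow n ⊗ W                              ≈⟨ ≈-sym (⊗-identityˡ (xpow n ⊗ W)) ⟩
    𝟙 ⊗ (xpow n ⊗ W)                        ≈⟨ pmul-congˡ-≈ (xpow n ⊗ W) (≈-sym c'c≈1) ⟩
    κ c' ⊗ κ (suc n) ⊗ (xpow n ⊗ W)         ≈⟨ solve 3 (λ c' c A → c' :* c :* A := c' :* (c :* A)) ≈-refl (κ c') (κ (suc n)) (xpow n ⊗ W) ⟩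
    κ c' ⊗ (κ (suc n) ⊗ (xpow n ⊗ W))       ≈⟨ pmul-congʳ-≈ (κ c') (≈-sym D[xpow⊗W]) ⟩
    κ c' ⊗ D (xpow (suc n) ⊗ W)             ≈⟨ ≈-sym (leibniz (κ c') (xpow (suc n) ⊗ W)) ⟩
    D (κ c' ⊗ (xpow (suc n) ⊗ W))           ∎)
    where
    open ≈-Reasoning
    D[xpow⊗W] : D (xpow (suc n) ⊗ W) ≈ κ (suc n) ⊗ (xpow n ⊗ W)
    D[xpow⊗W] = begin
      D (xpow (suc n) ⊗ W)                               ≈⟨ leibniz (xpow (suc n)) W ⟩
      D (xpow (suc n)) ⊗ W ⊕ xpow (suc n) ⊗ D W          ≈⟨ padd-cong (pmul-congˡ-≈ W (D-xpow n)) (pmul-congʳ-≈ (xpow (suc n)) DW≈0) ⟩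
      κ (suc n) ⊗ xpow n ⊗ W ⊕ xpow (suc n) ⊗ 𝟘          ≈⟨ padd-cong {κ (suc n) ⊗ xpow n ⊗ W} ≈-refl (⊗-zeroʳ (xpow (suc n))) ⟩
      κ (suc n) ⊗ xpow n ⊗ W ⊕ 𝟘                         ≈⟨ solve 3 (λ c A W → c :* A :* W :+ con 0 := c :* (A :* W)) ≈-refl (κ (suc n)) (xpow n) W ⟩
      κ (suc n) ⊗ (xpow n ⊗ W)                           ∎

  Exact⇒coeff≡0 : ∀ {Z} → Exact Z → ∀ n → suc n % p ≡ 0 → coeff Z n % p ≡ 0
  Exact⇒coeff≡0 (Q , Z≈DQ) n p∣1+n =
    trans (≈-coeff Z≈DQ n) (trans (cong (_% p) (coeff-D Q n)) (m%p≡0⇒[m*n]%p≡0 {suc n} p∣1+n))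

  -- C is a polynomial in x^p, so its degree e is divisible by p and C has no other coefficient
  -- within distance p below e; hence coefficient e + j of G C is C_e G_j, and e + j ≡ -1 (mod p).
  Exact-⊗-constant⇒coeff≡0 : ∀ C G j → ¬ IsZero C → D C ≈ 𝟘 → suc j ≡ p →
    VanishesFrom G (j + p) → Exact (G ⊗ C) → coeff G j % p ≡ 0
  Exact-⊗-constant⇒coeff≡0 C G j C≢0 DC≈0 1+j≡p vG exact with degree C C≢0
  ... | e , lead , vC with m*n%p≡0⇒m%p≡0⊎n%p≡0 (coeff C e) (coeff G j) leading-term
    where
    p∣e : e % p ≡ 0
    p∣e with e % p ≟ 0
    ... | yes p∣e = p∣e
    ... | no  p∤e = ⊥-elim (lead (D≈𝟘⇒coeff≡0 C DC≈0 e p∤e))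
    gap : ∀ b → b < e → e ∸ b < p → coeff C b % p ≡ 0
    gap b b<e e∸b<p with b % p ≟ 0
    ... | no  p∤b = D≈𝟘⇒coeff≡0 C DC≈0 b p∤b
    ... | yes p∣b = ⊥-elim (<⇒≱ e∸b<p (∣⇒≤ {{>-nonZero (m<n⇒0<n∸m b<e)}} p∣e∸b))
      where
      p∣e∸b : p ∣ e ∸ b
      p∣e∸b = ∣m+n∣m⇒∣n (subst (p ∣_) (sym (m+[n∸m]≡n (<⇒≤ b<e))) (m%n≡0⇒n∣m e p p∣e)) (m%n≡0⇒n∣m b p p∣b)
    p∣1+e+j : suc (e + j) % p ≡ 0
    p∣1+e+j = trans (cong (_% p) (trans (sym (+-suc e j)) (cong (e +_) 1+j≡p))) (trans ([m+n]%n≡m%n e p) p∣e)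
    leading-term : (coeff C e * coeff G j) % p ≡ 0
    leading-term = trans (sym (coeff-⊗-isolated e p j C G vC gap vG))
                         (Exact⇒coeff≡0 (Exact-cong (pmul-comm-≈ G C) exact) (e + j) p∣1+e+j)
  ... | inj₁ C_e≡0 = ⊥-elim (lead C_e≡0)
  ... | inj₂ G_j≡0 = G_j≡0

module SeparableCubic (p : ℕ) .{{_ : NonZero p}} (p-prime : Prime p)
                      (a0 a1 a2 : ℕ) (separable : Separable p (cubic a0 a1 a2)) where

  open PrimeField p p-prime public

  f f′ : Poly
  f  = cubic a0 a1 a2
  f′ = D f

  f-vanishesFrom-4 : VanishesFrom f 4
  f-vanishesFrom-4 (suc (suc (suc (suc n)))) _ = 0%p≡0
  f-vanishesFrom-4 1 (s≤s ())
  f-vanishesFrom-4 2 (s≤s (s≤s ()))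
  f-vanishesFrom-4 3 (s≤s (s≤s (s≤s ())))

  f′-vanishesFrom-3 : VanishesFrom f′ 3
  f′-vanishesFrom-3 = vanishesFrom-D f 3 f-vanishesFrom-4

  f≢0 : ¬ IsZero f
  f≢0 v = 0≢1+n (trans (sym (v 3 z≤n)) 1%p≡1)

  s t : Poly
  s = proj₁ separable
  t = proj₁ (proj₂ separable)

  s⊗f⊕t⊗f′≈𝟙 : s ⊗ f ⊕ t ⊗ f′ ≈ 𝟙
  s⊗f⊕t⊗f′≈𝟙 = ⟨ proj₂ (proj₂ separable) ⟩

  f⊗-vanishesFrom : ∀ k Q → VanishesFrom (f ⊗ Q) (3 + k) → VanishesFrom Q k
  f⊗-vanishesFrom k Q vfQ n k≤n with coeff Q n % p ≟ 0
  ... | yes Q_n≡0 = Q_n≡0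
  ... | no  Q_n≢0 with degree Q (λ v → Q_n≢0 (v n z≤n))
  ...   | e , lead , vQ = ⊥-elim (lead (begin
    coeff Q e % p                ≡⟨ cong (_% p) (sym (*-identityˡ (coeff Q e))) ⟩
    (1 * coeff Q e) % p          ≡⟨ sym (coeff-⊗-isolated 3 1 e f Q f-vanishesFrom-4 no-gap vQ′) ⟩
    coeff (f ⊗ Q) (3 + e) % p    ≡⟨ vfQ (3 + e) (+-monoʳ-≤ 3 k≤e) ⟩
    0                            ∎))
    where
    open ≡-Reasoning
    k≤e : k ≤ e
    k≤e with n ≤? e
    ... | yes n≤e = ≤-trans k≤n n≤e
    ... | no  n≰e = ⊥-elim (Q_n≢0 (vQ n (≰⇒> n≰e)))
    no-gap : ∀ b → b < 3 → 3 ∸ b < 1 → coeff f b % p ≡ 0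
    no-gap b b<3 3∸b<1 = ⊥-elim (<⇒≱ 3∸b<1 (m<n⇒0<n∸m b<3))
    vQ′ : VanishesFrom Q (e + 1)
    vQ′ = vanishesFrom-mono Q (≤-reflexive (+-comm 1 e)) vQ

  Solves : ℕ → Poly → Set
  Solves c P = f ⊗ D P ≈ κ c ⊗ f′ ⊗ P

  f∣solution : ∀ c → c % p ≢ 0 → ∀ P → Solves c P → Σ Poly λ Q → P ≈ f ⊗ Q
  f∣solution c c≢0 P solves with κ-invertible c c≢0
  ... | c' , c'c≈1 = s ⊗ P ⊕ κ c' ⊗ t ⊗ D P , (begin
    P                                                 ≈⟨ solve 1 (λ P → P := P :* con 1) ≈-refl P ⟩
    P ⊗ 𝟙                                             ≈⟨ pmul-congʳ-≈ P (≈-sym s⊗f⊕t⊗f′≈𝟙) ⟩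
    P ⊗ (s ⊗ f ⊕ t ⊗ f′)                              ≈⟨ pmul-congʳ-≈ P (padd-cong {s ⊗ f} ≈-refl (pmul-congʳ-≈ t f′≈c'cf′)) ⟩
    P ⊗ (s ⊗ f ⊕ t ⊗ (κ c' ⊗ κ c ⊗ f′))               ≈⟨ solve 7 (λ P s f t c' c f′ → P :* (s :* f :+ t :* (c' :* c :* f′))
                                                                     := f :* (s :* P) :+ c' :* t :* (c :* f′ :* P))
                                                                 ≈-refl P s f t (κ c') (κ c) f′ ⟩
    f ⊗ (s ⊗ P) ⊕ κ c' ⊗ t ⊗ (κ c ⊗ f′ ⊗ P)           ≈⟨ padd-cong {f ⊗ (s ⊗ P)} ≈-refl (pmul-congʳ-≈ (κ c' ⊗ t) (≈-sym solves)) ⟩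
    f ⊗ (s ⊗ P) ⊕ κ c' ⊗ t ⊗ (f ⊗ D P)                ≈⟨ solve 6 (λ f s P c' t DP → f :* (s :* P) :+ c' :* t :* (f :* DP)
                                                                     := f :* (s :* P :+ c' :* t :* DP))
                                                                 ≈-refl f s P (κ c') t (D P) ⟩
    f ⊗ (s ⊗ P ⊕ κ c' ⊗ t ⊗ D P)                      ∎)
    where
    open ≈-Reasoning
    f′≈c'cf′ : f′ ≈ κ c' ⊗ κ c ⊗ f′
    f′≈c'cf′ = ≈-trans (≈-sym (⊗-identityˡ f′)) (pmul-congˡ-≈ f′ (≈-sym c'c≈1))

  Solves-÷f : ∀ c Q → Solves (suc c) (f ⊗ Q) → Solves c Q
  Solves-÷f c Q solves = ⊗-cancelˡ f (f ⊗ D Q) (κ c ⊗ f′ ⊗ Q) f≢0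
    (⊕-cancelʳ (f ⊗ (f ⊗ D Q)) (f ⊗ (κ c ⊗ f′ ⊗ Q)) (f ⊗ (f′ ⊗ Q)) (begin
      f ⊗ (f ⊗ D Q) ⊕ f ⊗ (f′ ⊗ Q)        ≈⟨ solve 4 (λ f DQ f′ Q → f :* (f :* DQ) :+ f :* (f′ :* Q) := f :* (f′ :* Q :+ f :* DQ))
                                                      ≈-refl f (D Q) f′ Q ⟩
      f ⊗ (f′ ⊗ Q ⊕ f ⊗ D Q)              ≈⟨ pmul-congʳ-≈ f (≈-sym (leibniz f Q)) ⟩
      f ⊗ D (f ⊗ Q)                       ≈⟨ solves ⟩
      κ (suc c) ⊗ f′ ⊗ (f ⊗ Q)            ≈⟨ pmul-congˡ-≈ (f ⊗ Q) (pmul-congˡ-≈ f′ (κ-suc c)) ⟩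
      (κ c ⊕ 𝟙) ⊗ f′ ⊗ (f ⊗ Q)            ≈⟨ solve 4 (λ c f f′ Q → (c :+ con 1) :* f′ :* (f :* Q) := f :* (c :* f′ :* Q) :+ f :* (f′ :* Q))
                                                      ≈-refl (κ c) f f′ Q ⟩
      f ⊗ (κ c ⊗ f′ ⊗ Q) ⊕ f ⊗ (f′ ⊗ Q)   ∎))
    where open ≈-Reasoning

  -- A solution of f P′ = c f′ P behaves like f^c: separability forces f ∣ P and P / f solves
  -- the equation for c - 1, so a degree below 3k with k ≤ c leaves only P = 0.
  Solves⇒≈𝟘 : ∀ k c → k ≤ c → c < p → ∀ P → VanishesFrom P (3 * k) → Solves c P → P ≈ 𝟘
  Solves⇒≈𝟘 zero    c       _         _   P vP _ = IsZero⇒≈𝟘 {P} vP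
  Solves⇒≈𝟘 (suc k) (suc c) (s≤s k≤c) c<p P vP solves = from-quotient (f∣solution (suc c) c≢0 P solves)
    where
    c≢0 : suc c % p ≢ 0
    c≢0 e = 0≢1+n (trans (sym e) (m<n⇒m%n≡m c<p))
    vP′ : VanishesFrom P (3 + 3 * k)
    vP′ = vanishesFrom-mono P (≤-reflexive (*-suc 3 k)) vP
    from-quotient : Σ Poly (λ Q → P ≈ f ⊗ Q) → P ≈ 𝟘
    from-quotient (Q , P≈fQ) = ≈-trans P≈fQ (≈-trans (pmul-congʳ-≈ f Q≈𝟘) (⊗-zeroʳ f))
      where
      Q-solves : Solves c Q
      Q-solves = Solves-÷f c Q (≈-trans (pmul-congʳ-≈ f (D-cong (≈-sym P≈fQ)))
                                  (≈-trans solves (pmul-congʳ-≈ (κ (suc c) ⊗ f′) P≈fQ)))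
      vQ : VanishesFrom Q (3 * k)
      vQ = f⊗-vanishesFrom (3 * k) Q (vanishesFrom-cong (3 + 3 * k) P≈fQ vP′)
      Q≈𝟘 : Q ≈ 𝟘
      Q≈𝟘 = Solves⇒≈𝟘 k c k≤c (<-trans (n<1+n c) c<p) Q vQ Q-solves

  κ-vanishesFrom-1 : ∀ c → VanishesFrom (κ c) 1
  κ-vanishesFrom-1 c (suc n) _ = 0%p≡0

  -- As D (x^p) = 0, both sides split at x^p; the degree bound keeps the low parts below x^p.
  Solves-split : ∀ c P r → p ≡ 3 + r → VanishesFrom (take p P) (suc r) → Solves c P →
                 Solves c (take p P) × Solves c (drop p P)
  Solves-split c P r p≡3+r vLo solves =
    ⊕xpow⊗-injective p (f ⊗ D Lo) (f ⊗ D Hi) (κ c ⊗ f′ ⊗ Lo) (κ c ⊗ f′ ⊗ Hi) v₁ v₂ split-equation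
    where
    open ≈-Reasoning
    Lo Hi : Poly
    Lo = take p P
    Hi = drop p P
    P-split : P ≈ Lo ⊕ xpow p ⊗ Hi
    P-split = take⊕xpow⊗drop p P
    D-split : D P ≈ D Lo ⊕ xpow p ⊗ D Hi
    D-split = begin
      D P                                          ≈⟨ D-cong P-split ⟩
      D (Lo ⊕ xpow p ⊗ Hi)                         ≈⟨ D-⊕ Lo (xpow p ⊗ Hi) ⟩
      D Lo ⊕ D (xpow p ⊗ Hi)                       ≈⟨ padd-cong {D Lo} ≈-refl (leibniz (xpow p) Hi) ⟩
      D Lo ⊕ (D (xpow p) ⊗ Hi ⊕ xpow p ⊗ D Hi)     ≈⟨ padd-cong {D Lo} ≈-refl (padd-cong (pmul-congˡ-≈ Hi D-xpow-p≈𝟘) ≈-refl) ⟩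
      D Lo ⊕ xpow p ⊗ D Hi                         ∎
    split-equation : f ⊗ D Lo ⊕ xpow p ⊗ (f ⊗ D Hi) ≈ κ c ⊗ f′ ⊗ Lo ⊕ xpow p ⊗ (κ c ⊗ f′ ⊗ Hi)
    split-equation = begin
      f ⊗ D Lo ⊕ xpow p ⊗ (f ⊗ D Hi)              ≈⟨ solve 4 (λ f A x B → f :* A :+ x :* (f :* B) := f :* (A :+ x :* B))
                                                               ≈-refl f (D Lo) (xpow p) (D Hi) ⟩
      f ⊗ (D Lo ⊕ xpow p ⊗ D Hi)                  ≈⟨ pmul-congʳ-≈ f (≈-sym D-split) ⟩
      f ⊗ D P                                     ≈⟨ solves ⟩
      κ c ⊗ f′ ⊗ P                                ≈⟨ pmul-congʳ-≈ (κ c ⊗ f′) P-split ⟩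
      κ c ⊗ f′ ⊗ (Lo ⊕ xpow p ⊗ Hi)               ≈⟨ solve 5 (λ k f′ A x B → k :* f′ :* (A :+ x :* B) := k :* f′ :* A :+ x :* (k :* f′ :* B))
                                                               ≈-refl (κ c) f′ Lo (xpow p) Hi ⟩
      κ c ⊗ f′ ⊗ Lo ⊕ xpow p ⊗ (κ c ⊗ f′ ⊗ Hi)    ∎
    v₁ : VanishesFrom (f ⊗ D Lo) p
    v₁ = vanishesFrom-mono (f ⊗ D Lo) (≤-reflexive (sym p≡3+r))
           (vanishesFrom-⊗ 3 f (D Lo) r f-vanishesFrom-4 (vanishesFrom-D Lo r vLo))
    v₂ : VanishesFrom (κ c ⊗ f′ ⊗ Lo) p
    v₂ = vanishesFrom-mono (κ c ⊗ f′ ⊗ Lo) (≤-reflexive (sym p≡3+r))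
           (vanishesFrom-⊗ 2 (κ c ⊗ f′) Lo (suc r)
             (vanishesFrom-⊗ 0 (κ c) f′ 3 (κ-vanishesFrom-1 c) f′-vanishesFrom-3) vLo)

  Solves-ppow-f : ∀ n → Solves n (ppow f n)
  Solves-ppow-f zero    = ≈-trans (⊗-zeroʳ f) (≈-sym (pmul-congˡ-≈ 𝟙 (pmul-congˡ-≈ f′ κ0≈𝟘)))
  Solves-ppow-f (suc n) = ≈-trans (pmul-congʳ-≈ f (D-ppow f n))
    (solve 4 (λ f k A f′ → f :* (k :* A :* f′) := k :* f′ :* (A :* f)) ≈-refl f (κ (suc n)) (ppow f n) f′)

  ppow-f-vanishesFrom : ∀ n → VanishesFrom (ppow f n) (suc (3 * n))
  ppow-f-vanishesFrom zero    (suc k) _ = 0%p≡0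
  ppow-f-vanishesFrom (suc n) = vanishesFrom-mono (ppow f (suc n)) (≤-reflexive 3n+4≡1+3[1+n])
    (vanishesFrom-⊗ (3 * n) (ppow f n) f 4 (ppow-f-vanishesFrom n) f-vanishesFrom-4)
    where
    3n+4≡1+3[1+n] : 3 * n + 4 ≡ suc (3 * suc n)
    3n+4≡1+3[1+n] = sym (trans (cong suc (*-suc 3 n)) (+-comm 4 (3 * n)))

  coeff-ppow-f-top : ∀ n → coeff (ppow f n) (3 * n) % p ≡ 1
  coeff-ppow-f-top zero    = 1%p≡1
  coeff-ppow-f-top (suc n) = begin
    coeff (ppow f (suc n)) (3 * suc n) % p       ≡⟨ cong (λ k → coeff (ppow f (suc n)) k % p) (trans (*-suc 3 n) (+-comm 3 (3 * n))) ⟩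
    coeff (ppow f n ⊗ f) (3 * n + 3) % p
      ≡⟨ coeff-⊗-isolated (3 * n) 1 3 (ppow f n) f (ppow-f-vanishesFrom n) no-gap f-vanishesFrom-4 ⟩
    (coeff (ppow f n) (3 * n) * 1) % p           ≡⟨ cong (_% p) (*-identityʳ _) ⟩
    coeff (ppow f n) (3 * n) % p                 ≡⟨ coeff-ppow-f-top n ⟩
    1                                            ∎
    where
    open ≡-Reasoning
    no-gap : ∀ b → b < 3 * n → 3 * n ∸ b < 1 → coeff (ppow f n) b % p ≡ 0
    no-gap b b<3n 3n∸b<1 = ⊥-elim (<⇒≱ 3n∸b<1 (m<n⇒0<n∸m b<3n))

module HalfPower (p : ℕ) .{{_ : NonZero p}} (p-prime : Prime p)
                 (a0 a1 a2 : ℕ) (separable : Separable p (cubic a0 a1 a2))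
                 (m' : ℕ) (p≡1+2m : p ≡ suc (suc m' + suc m')) where

  open SeparableCubic p p-prime a0 a1 a2 separable public

  m r : ℕ
  m = suc m'
  r = m' + m'

  p≡3+r : p ≡ 3 + r
  p≡3+r = trans p≡1+2m (cong (λ k → suc (suc k)) (+-suc m' m'))

  g : Poly
  g = ppow f m

  m<p : m < p
  m<p = subst (m <_) (sym p≡1+2m) (s≤s (s≤s (m≤m+n m' (suc m'))))

  1+r≤3m : suc r ≤ 3 * m
  1+r≤3m = ≤-trans (s≤s (+-monoʳ-≤ m' (n≤1+n m'))) (+-monoʳ-≤ m (m≤m+n m (m + 0)))

  take-p-g-vanishesFrom : coeff g (p ∸ 2) % p ≡ 0 → coeff g (p ∸ 1) % p ≡ 0 → VanishesFrom (take p g) (suc r)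
  take-p-g-vanishesFrom g[p-2]≡0 g[p-1]≡0 n 1+r≤n with suc r ≟ n | suc (suc r) ≟ n
  ... | yes refl | _        = trans (cong (_% p) (coeff-take-< p g n 1+r<p))
                                    (subst (λ k → coeff g k % p ≡ 0) (cong (_∸ 2) p≡3+r) g[p-2]≡0)
    where
    1+r<p : suc r < p
    1+r<p = subst (suc r <_) (sym p≡3+r) (≤-trans (n<1+n (suc r)) (n≤1+n (suc (suc r))))
  ... | no _     | yes refl = trans (cong (_% p) (coeff-take-< p g n (subst (suc (suc r) <_) (sym p≡3+r) ≤-refl)))
                                    (subst (λ k → coeff g k % p ≡ 0) (cong (_∸ 1) p≡3+r) g[p-1]≡0)
  ... | no 1+r≢n | no 2+r≢n = trans (cong (_% p) (coeff-take-≥ p g n p≤n)) 0%p≡0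
    where
    p≤n : p ≤ n
    p≤n = subst (_≤ n) (sym p≡3+r) (≤∧≢⇒< (≤∧≢⇒< 1+r≤n 1+r≢n) 2+r≢n)

  drop-p-g-vanishesFrom : VanishesFrom (drop p g) (3 * m)
  drop-p-g-vanishesFrom n 3m≤n = trans (cong (_% p) (coeff-drop p g n))
    (ppow-f-vanishesFrom m (p + n) (≤-trans (s≤s 3m≤n) (+-monoˡ-≤ n (>-nonZero⁻¹ p))))

  -- Otherwise the parts of f^m below and above x^p both solve f P′ = m f′ P in degree < 3m.
  coeff-g[p∸2,p∸1]-not-both-zero : coeff g (p ∸ 2) % p ≡ 0 → coeff g (p ∸ 1) % p ≡ 0 → ⊥
  coeff-g[p∸2,p∸1]-not-both-zero g[p-2]≡0 g[p-1]≡0 =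
    0≢1+n (trans (sym (≈𝟘⇒IsZero {g} g≈𝟘 (3 * m) z≤n)) (coeff-ppow-f-top m))
    where
    vLo : VanishesFrom (take p g) (suc r)
    vLo = take-p-g-vanishesFrom g[p-2]≡0 g[p-1]≡0
    parts-solve : Solves m (take p g) × Solves m (drop p g)
    parts-solve = Solves-split m g r p≡3+r vLo (Solves-ppow-f m)
    Lo≈𝟘 : take p g ≈ 𝟘
    Lo≈𝟘 = Solves⇒≈𝟘 m m ≤-refl m<p (take p g) (vanishesFrom-mono (take p g) 1+r≤3m vLo) (proj₁ parts-solve)
    Hi≈𝟘 : drop p g ≈ 𝟘
    Hi≈𝟘 = Solves⇒≈𝟘 m m ≤-refl m<p (drop p g) drop-p-g-vanishesFrom (proj₂ parts-solve)
    g≈𝟘 : g ≈ 𝟘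
    g≈𝟘 = ≈-trans (take⊕xpow⊗drop p g)
      (padd-cong Lo≈𝟘 (≈-trans (pmul-congʳ-≈ (xpow p) Hi≈𝟘) (⊗-zeroʳ (xpow p))))

module FunctionField (p : ℕ) .{{_ : NonZero p}} (p-prime : Prime p)
                     (a0 a1 a2 : ℕ) (separable : Separable p (cubic a0 a1 a2))
                     (m' : ℕ) (p≡1+2m : p ≡ suc (suc m' + suc m')) where

  open HalfPower p p-prime a0 a1 a2 separable m' p≡1+2m public

  -- δ (a + b y) = δ₀ a + δ₁ b · y is the derivation 2f d/dx of F_p[x][y]/(y² − f), as δ y = f′ y.
  δ₀ δ₁ : Poly → Poly
  δ₀ a = κ 2 ⊗ f ⊗ D a
  δ₁ b = κ 2 ⊗ f ⊗ D b ⊕ b ⊗ f′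

  module Power (a b d : Poly) where

    A B : ℕ → Poly
    A n = num0 (epow f (elt a b d) n)
    B n = num1 (epow f (elt a b d) n)

    -- The two components of δ (u^(n+1)) = (n + 1) u^n δ u for u = a + b y.
    δ₀-rule δ₁-rule : ℕ → Set
    δ₀-rule n = δ₀ (A (suc n)) ≈ κ (suc n) ⊗ (A n ⊗ δ₀ a ⊕ B n ⊗ δ₁ b ⊗ f)
    δ₁-rule n = δ₁ (B (suc n)) ≈ κ (suc n) ⊗ (A n ⊗ δ₁ b ⊕ B n ⊗ δ₀ a)

    δ₀-step : ∀ n → δ₀-rule n → δ₁-rule n → δ₀-rule (suc n)
    δ₀-step n ih₀ ih₁ = begin
      κ 2 ⊗ f ⊗ D (P ⊗ a ⊕ Q ⊗ b ⊗ f)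
        ≈⟨ pmul-congʳ-≈ (κ 2 ⊗ f) (≈-trans (D-⊕ (P ⊗ a) (Q ⊗ b ⊗ f))
             (padd-cong (leibniz P a) (≈-trans (leibniz (Q ⊗ b) f) (padd-cong (pmul-congˡ-≈ f (leibniz Q b)) ≈-refl)))) ⟩
      κ 2 ⊗ f ⊗ (D P ⊗ a ⊕ P ⊗ D a ⊕ ((D Q ⊗ b ⊕ Q ⊗ D b) ⊗ f ⊕ Q ⊗ b ⊗ f′))
        ≈⟨ solve 10 (λ P Q a b f Da Db DP DQ f′ →
             con 2 :* f :* (DP :* a :+ P :* Da :+ ((DQ :* b :+ Q :* Db) :* f :+ Q :* b :* f′))
             := (con 2 :* f :* DP) :* a :+ P :* (con 2 :* f :* Da) :+ (con 2 :* f :* DQ :+ Q :* f′) :* b :* f :+ Q :* (con 2 :* f :* Db :+ b :* f′) :* f)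
             ≈-refl P Q a b f (D a) (D b) (D P) (D Q) f′ ⟩
      δ₀ P ⊗ a ⊕ P ⊗ δ₀ a ⊕ δ₁ Q ⊗ b ⊗ f ⊕ Q ⊗ δ₁ b ⊗ f
        ≈⟨ padd-cong (padd-cong (padd-cong (pmul-congˡ-≈ a ih₀) ≈-refl) (pmul-congˡ-≈ f (pmul-congˡ-≈ b ih₁))) ≈-refl ⟩
      k ⊗ (A n ⊗ δ₀ a ⊕ B n ⊗ δ₁ b ⊗ f) ⊗ a ⊕ P ⊗ δ₀ a ⊕ k ⊗ (A n ⊗ δ₁ b ⊕ B n ⊗ δ₀ a) ⊗ b ⊗ f ⊕ Q ⊗ δ₁ b ⊗ f
        ≈⟨ solve 8 (λ k An Bn a b f X Y →
             k :* (An :* X :+ Bn :* Y :* f) :* a :+ (An :* a :+ Bn :* b :* f) :* X :+ k :* (An :* Y :+ Bn :* X) :* b :* f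
               :+ (An :* b :+ Bn :* a) :* Y :* f
             := (k :+ con 1) :* ((An :* a :+ Bn :* b :* f) :* X :+ (An :* b :+ Bn :* a) :* Y :* f))
             ≈-refl k (A n) (B n) a b f (δ₀ a) (δ₁ b) ⟩
      (k ⊕ 𝟙) ⊗ (P ⊗ δ₀ a ⊕ Q ⊗ δ₁ b ⊗ f)
        ≈⟨ pmul-congˡ-≈ (P ⊗ δ₀ a ⊕ Q ⊗ δ₁ b ⊗ f) (≈-sym (κ-suc (suc n))) ⟩
      κ (suc (suc n)) ⊗ (P ⊗ δ₀ a ⊕ Q ⊗ δ₁ b ⊗ f)
        ∎
      where
      open ≈-Reasoning
      P = A (suc n)
      Q = B (suc n)
      k = κ (suc n)

    δ₁-step : ∀ n → δ₀-rule n → δ₁-rule n → δ₁-rule (suc n)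
    δ₁-step n ih₀ ih₁ = begin
      κ 2 ⊗ f ⊗ D (P ⊗ b ⊕ Q ⊗ a) ⊕ (P ⊗ b ⊕ Q ⊗ a) ⊗ f′
        ≈⟨ padd-cong (pmul-congʳ-≈ (κ 2 ⊗ f) (≈-trans (D-⊕ (P ⊗ b) (Q ⊗ a)) (padd-cong (leibniz P b) (leibniz Q a)))) ≈-refl ⟩
      κ 2 ⊗ f ⊗ (D P ⊗ b ⊕ P ⊗ D b ⊕ (D Q ⊗ a ⊕ Q ⊗ D a)) ⊕ (P ⊗ b ⊕ Q ⊗ a) ⊗ f′
        ≈⟨ solve 10 (λ P Q a b f Da Db DP DQ f′ →
             con 2 :* f :* (DP :* b :+ P :* Db :+ (DQ :* a :+ Q :* Da)) :+ (P :* b :+ Q :* a) :* f′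
             := (con 2 :* f :* DP) :* b :+ P :* (con 2 :* f :* Db :+ b :* f′) :+ (con 2 :* f :* DQ :+ Q :* f′) :* a :+ Q :* (con 2 :* f :* Da))
             ≈-refl P Q a b f (D a) (D b) (D P) (D Q) f′ ⟩
      δ₀ P ⊗ b ⊕ P ⊗ δ₁ b ⊕ δ₁ Q ⊗ a ⊕ Q ⊗ δ₀ a
        ≈⟨ padd-cong (padd-cong (padd-cong (pmul-congˡ-≈ b ih₀) ≈-refl) (pmul-congˡ-≈ a ih₁)) ≈-refl ⟩
      k ⊗ (A n ⊗ δ₀ a ⊕ B n ⊗ δ₁ b ⊗ f) ⊗ b ⊕ P ⊗ δ₁ b ⊕ k ⊗ (A n ⊗ δ₁ b ⊕ B n ⊗ δ₀ a) ⊗ a ⊕ Q ⊗ δ₀ a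
        ≈⟨ solve 8 (λ k An Bn a b f X Y →
             k :* (An :* X :+ Bn :* Y :* f) :* b :+ (An :* a :+ Bn :* b :* f) :* Y :+ k :* (An :* Y :+ Bn :* X) :* a
               :+ (An :* b :+ Bn :* a) :* X
             := (k :+ con 1) :* ((An :* a :+ Bn :* b :* f) :* Y :+ (An :* b :+ Bn :* a) :* X))
             ≈-refl k (A n) (B n) a b f (δ₀ a) (δ₁ b) ⟩
      (k ⊕ 𝟙) ⊗ (P ⊗ δ₁ b ⊕ Q ⊗ δ₀ a)
        ≈⟨ pmul-congˡ-≈ (P ⊗ δ₁ b ⊕ Q ⊗ δ₀ a) (≈-sym (κ-suc (suc n))) ⟩
      κ (suc (suc n)) ⊗ (P ⊗ δ₁ b ⊕ Q ⊗ δ₀ a)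
        ∎
      where
      open ≈-Reasoning
      P = A (suc n)
      Q = B (suc n)
      k = κ (suc n)

    δ-rules : ∀ n → δ₀-rule n × δ₁-rule n
    δ-rules zero    = base₀ , base₁
      where
      𝟙⊗c⊕𝟘≈c : ∀ c → 𝟙 ⊗ c ⊕ 𝟘 ≈ c
      𝟙⊗c⊕𝟘≈c c = ≈-trans (padd-identityʳ (𝟙 ⊗ c)) (⊗-identityˡ c)
      base₀ : δ₀-rule zero
      base₀ = ≈-trans (pmul-congʳ-≈ (κ 2 ⊗ f) (D-cong (𝟙⊗c⊕𝟘≈c a)))
                      (≈-sym (≈-trans (⊗-identityˡ (𝟙 ⊗ δ₀ a ⊕ 𝟘)) (𝟙⊗c⊕𝟘≈c (δ₀ a))))
      base₁ : δ₁-rule zero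
      base₁ = ≈-trans (padd-cong (pmul-congʳ-≈ (κ 2 ⊗ f) (D-cong (𝟙⊗c⊕𝟘≈c b))) (pmul-congˡ-≈ f′ (𝟙⊗c⊕𝟘≈c b)))
                      (≈-sym (≈-trans (⊗-identityˡ (𝟙 ⊗ δ₁ b ⊕ 𝟘)) (𝟙⊗c⊕𝟘≈c (δ₁ b))))
    δ-rules (suc n) with δ-rules n
    ... | ih₀ , ih₁ = δ₀-step n ih₀ ih₁ , δ₁-step n ih₀ ih₁

    δ₁-B-p≈𝟘 : δ₁ (B p) ≈ 𝟘
    δ₁-B-p≈𝟘 = ≈-trans (subst (λ q → δ₁ (B q) ≈ κ q ⊗ R) (suc[p∸1]≡p) (proj₂ (δ-rules (p ∸ 1))))
                       (pmul-congˡ-≈ R κp≈𝟘)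
      where R = A (p ∸ 1) ⊗ δ₁ b ⊕ B (p ∸ 1) ⊗ δ₀ a

    den-epow : ∀ n → den (epow f (elt a b d) n) ≡ ppow d n
    den-epow zero    = refl
    den-epow (suc n) = cong (_⊗ d) (den-epow n)

    D-den-p≈𝟘 : D (den (epow f (elt a b d) p)) ≈ 𝟘
    D-den-p≈𝟘 = subst (λ P → D P ≈ 𝟘) (sym (den-epow p))
      (≈-trans (subst (λ q → D (ppow d q) ≈ κ q ⊗ ppow d (p ∸ 1) ⊗ D d) (suc[p∸1]≡p) (D-ppow d (p ∸ 1)))
               (pmul-congˡ-≈ (D d) (pmul-congˡ-≈ (ppow d (p ∸ 1)) κp≈𝟘)))

    den-p≢0 : ¬ IsZero d → ¬ IsZero (den (epow f (elt a b d) p))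
    den-p≢0 d≢0 = subst (λ P → ¬ IsZero P) (sym (den-epow p)) (¬IsZero-ppow d d≢0 p)

    B≈𝟘 : b ≈ 𝟘 → ∀ n → B n ≈ 𝟘
    B≈𝟘 b≈0 zero    = ≈-refl
    B≈𝟘 b≈0 (suc n) = ≈-trans (padd-cong (pmul-congʳ-≈ (A n) b≈0) (pmul-congˡ-≈ a (B≈𝟘 b≈0 n)))
                              (padd-cong (⊗-zeroʳ (A n)) ≈-refl)

  κ2⊗[κm⊕𝟙]≈𝟙 : κ 2 ⊗ (κ m ⊕ 𝟙) ≈ 𝟙
  κ2⊗[κm⊕𝟙]≈𝟙 = ≈-trans (pmul-congʳ-≈ (κ 2) (≈-sym (κ-suc m)))
    (≈-trans (≈-sym (κ-* 2 (suc m))) (κ-mod (trans (cong (_% p) 2[1+m]≡1+p) ([m+n]%n≡m%n 1 p))))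
    where
    2[1+m]≡1+p : 2 * suc m ≡ 1 + p
    2[1+m]≡1+p = trans (arith m') (cong suc (sym p≡1+2m))
      where
      arith : ∀ x → 2 * suc (suc x) ≡ suc (suc (suc x + suc x))
      arith = solve-∀
        where open import Data.Nat.Tactic.RingSolver

  -- δ₁ B ≈ 𝟘 says that d/dx kills B y, hence also f^(m+1) B = y^p · B y.
  δ₁≈𝟘⇒D[f⊗g⊗B]≈𝟘 : ∀ B → δ₁ B ≈ 𝟘 → D (f ⊗ g ⊗ B) ≈ 𝟘
  δ₁≈𝟘⇒D[f⊗g⊗B]≈𝟘 B δ₁B≈0 = begin
    D V                              ≈⟨ ≈-sym (⊗-identityˡ (D V)) ⟩
    𝟙 ⊗ D V                          ≈⟨ pmul-congˡ-≈ (D V) (≈-sym κ2⊗[κm⊕𝟙]≈𝟙) ⟩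
    κ 2 ⊗ (κ m ⊕ 𝟙) ⊗ D V            ≈⟨ solve 3 (λ t k DV → t :* k :* DV := k :* (t :* DV)) ≈-refl (κ 2) (κ m ⊕ 𝟙) (D V) ⟩
    (κ m ⊕ 𝟙) ⊗ (κ 2 ⊗ D V)          ≈⟨ pmul-congʳ-≈ (κ m ⊕ 𝟙) (⊕-cancelʳ (κ 2 ⊗ D V) 𝟘 W 2DV⊕W≈W) ⟩
    (κ m ⊕ 𝟙) ⊗ 𝟘                    ≈⟨ ⊗-zeroʳ (κ m ⊕ 𝟙) ⟩
    𝟘                                ∎
    where
    open ≈-Reasoning
    V W : Poly
    V = f ⊗ g ⊗ B
    W = g ⊗ B ⊗ f′
    2DV⊕W≈W : κ 2 ⊗ D V ⊕ W ≈ W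
    2DV⊕W≈W = begin
      κ 2 ⊗ D V ⊕ W
        ≈⟨ padd-cong (pmul-congʳ-≈ (κ 2) (≈-trans (leibniz (f ⊗ g) B) (padd-cong (pmul-congˡ-≈ B (leibniz f g)) ≈-refl))) ≈-refl ⟩
      κ 2 ⊗ ((f′ ⊗ g ⊕ f ⊗ D g) ⊗ B ⊕ f ⊗ g ⊗ D B) ⊕ W
        ≈⟨ solve 6 (λ f g B f′ Dg DB → con 2 :* ((f′ :* g :+ f :* Dg) :* B :+ f :* g :* DB) :+ g :* B :* f′
                                        := con 2 :* f′ :* g :* B :+ con 2 :* (f :* Dg) :* B :+ g :* (con 2 :* f :* DB :+ B :* f′))
                   ≈-refl f g B f′ (D g) (D B) ⟩
      κ 2 ⊗ f′ ⊗ g ⊗ B ⊕ κ 2 ⊗ (f ⊗ D g) ⊗ B ⊕ g ⊗ δ₁ B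
        ≈⟨ padd-cong (padd-cong {κ 2 ⊗ f′ ⊗ g ⊗ B} ≈-refl (pmul-congˡ-≈ B (pmul-congʳ-≈ (κ 2) (Solves-ppow-f m))))
                     (≈-trans (pmul-congʳ-≈ g δ₁B≈0) (⊗-zeroʳ g)) ⟩
      κ 2 ⊗ f′ ⊗ g ⊗ B ⊕ κ 2 ⊗ (κ m ⊗ f′ ⊗ g) ⊗ B ⊕ 𝟘
        ≈⟨ solve 4 (λ k f′ g B → con 2 :* f′ :* g :* B :+ con 2 :* (k :* f′ :* g) :* B :+ con 0
                                     := con 2 :* (k :+ con 1) :* (g :* B :* f′))
                   ≈-refl (κ m) f′ g B ⟩
      κ 2 ⊗ (κ m ⊕ 𝟙) ⊗ W
        ≈⟨ pmul-congˡ-≈ W κ2⊗[κm⊕𝟙]≈𝟙 ⟩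
      𝟙 ⊗ W
        ≈⟨ ⊗-identityˡ W ⟩
      W ∎

  NonZeroPoly⇒¬IsZero : ∀ d → NonZeroPoly p d → ¬ IsZero d
  NonZeroPoly⇒¬IsZero d d≢0 v = d≢0 (λ n → trans (v n z≤n) (sym 0%p≡0))

  -- In h = Σ_{i<p} u_i^p x^i each x^i u_i^p with i < p - 1 is a derivative, and so is the y-part
  -- of x^(p-1) u_(p-1)^p when u_(p-1) has none. N n / Dn n is the y-part of the partial sum;
  -- multiplying by f^(m+1) turns each B y into a polynomial killed by d/dx.
  module BasisSum (u : ℕ → Elt) (den≢0 : ∀ i → i < p → ¬ IsZero (den (u i)))
                  (y-part≈𝟘 : ∀ i → suc i ≡ p → num1 (u i) ≈ 𝟘) where

    N Dn : ℕ → Poly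
    N  n = num1 (pBasisSum p f u n)
    Dn n = den (pBasisSum p f u n)

    Aᵖ Bᵖ dᵖ : ℕ → Poly
    Aᵖ i = num0 (epow f (u i) p)
    Bᵖ i = num1 (epow f (u i) p)
    dᵖ i = den (epow f (u i) p)

    N-step : ∀ n → N (suc n) ⊗ f ⊗ g ≈ (N n ⊗ f ⊗ g) ⊗ (dᵖ n ⊗ 𝟙) ⊕ xpow n ⊗ (f ⊗ g ⊗ Bᵖ n ⊗ Dn n)
    N-step n = begin
      (N n ⊗ (dᵖ n ⊗ 𝟙) ⊕ (Aᵖ n ⊗ 𝟘 ⊕ Bᵖ n ⊗ xpow n) ⊗ Dn n) ⊗ f ⊗ g
        ≈⟨ solve 8 (λ N E Z B x Dn f g → (N :* E :+ (Z :+ B :* x) :* Dn) :* f :* g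
                                         := (N :* f :* g) :* E :+ x :* (f :* g :* B :* Dn) :+ Z :* (Dn :* f :* g))
                   ≈-refl (N n) (dᵖ n ⊗ 𝟙) (Aᵖ n ⊗ 𝟘) (Bᵖ n) (xpow n) (Dn n) f g ⟩
      (N n ⊗ f ⊗ g) ⊗ (dᵖ n ⊗ 𝟙) ⊕ xpow n ⊗ (f ⊗ g ⊗ Bᵖ n ⊗ Dn n) ⊕ (Aᵖ n ⊗ 𝟘) ⊗ (Dn n ⊗ f ⊗ g)
        ≈⟨ padd-cong ≈-refl (pmul-congˡ-≈ (Dn n ⊗ f ⊗ g) (⊗-zeroʳ (Aᵖ n))) ⟩
      (N n ⊗ f ⊗ g) ⊗ (dᵖ n ⊗ 𝟙) ⊕ xpow n ⊗ (f ⊗ g ⊗ Bᵖ n ⊗ Dn n) ⊕ 𝟘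
        ≈⟨ padd-identityʳ _ ⟩
      (N n ⊗ f ⊗ g) ⊗ (dᵖ n ⊗ 𝟙) ⊕ xpow n ⊗ (f ⊗ g ⊗ Bᵖ n ⊗ Dn n)
        ∎
      where open ≈-Reasoning

    D[dᵖ⊗𝟙]≈𝟘 : ∀ n → D (dᵖ n ⊗ 𝟙) ≈ 𝟘
    D[dᵖ⊗𝟙]≈𝟘 n = D-⊗-constant (dᵖ n) 𝟙 D-den-p≈𝟘 ≈-refl
      where open Power (num0 (u n)) (num1 (u n)) (den (u n))

    dᵖ⊗𝟙≢0 : ∀ n → n < p → ¬ IsZero (dᵖ n ⊗ 𝟙)
    dᵖ⊗𝟙≢0 n n<p = ¬IsZero-⊗ (dᵖ n) 𝟙 (den-p≢0 (den≢0 n n<p)) (¬IsZero-𝟙 1<p)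
      where open Power (num0 (u n)) (num1 (u n)) (den (u n))

    new-term-exact : ∀ n → n < p → D (Dn n) ≈ 𝟘 → Exact (xpow n ⊗ (f ⊗ g ⊗ Bᵖ n ⊗ Dn n))
    new-term-exact n n<p DDn≈0 with suc n <? p
    ... | yes 1+n<p = Exact-xpow-⊗-constant n (f ⊗ g ⊗ Bᵖ n ⊗ Dn n) 1+n<p
                        (D-⊗-constant (f ⊗ g ⊗ Bᵖ n) (Dn n) (δ₁≈𝟘⇒D[f⊗g⊗B]≈𝟘 (Bᵖ n) δ₁-B-p≈𝟘) DDn≈0)
      where open Power (num0 (u n)) (num1 (u n)) (den (u n))
    ... | no  1+n≮p = Exact-cong (≈-sym new-term≈𝟘) Exact-𝟘
      where
      open Power (num0 (u n)) (num1 (u n)) (den (u n))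
      Bᵖ≈𝟘 : Bᵖ n ≈ 𝟘
      Bᵖ≈𝟘 = B≈𝟘 (y-part≈𝟘 n (≤-antisym n<p (≮⇒≥ 1+n≮p))) p
      new-term≈𝟘 : xpow n ⊗ (f ⊗ g ⊗ Bᵖ n ⊗ Dn n) ≈ 𝟘
      new-term≈𝟘 = ≈-trans (pmul-congʳ-≈ (xpow n) (pmul-congˡ-≈ (Dn n)
                             (≈-trans (pmul-congʳ-≈ (f ⊗ g) Bᵖ≈𝟘) (⊗-zeroʳ (f ⊗ g)))))
                           (⊗-zeroʳ (xpow n))

    Invariant : ℕ → Set
    Invariant n = Exact (N n ⊗ f ⊗ g) × (D (Dn n) ≈ 𝟘) × ¬ IsZero (Dn n)

    invariant : ∀ n → n ≤ p → Invariant n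
    invariant zero    _       = Exact-𝟘 , ≈-refl , ¬IsZero-𝟙 1<p
    invariant (suc n) 1+n≤p with invariant n (≤-trans (n≤1+n n) 1+n≤p)
    ... | exact , DDn≈0 , Dn≢0 =
      Exact-cong (≈-sym (N-step n))
        (Exact-⊕ (Exact-⊗-constant (dᵖ n ⊗ 𝟙) exact (D[dᵖ⊗𝟙]≈𝟘 n)) (new-term-exact n 1+n≤p DDn≈0)) ,
      D-⊗-constant (Dn n) (dᵖ n ⊗ 𝟙) DDn≈0 (D[dᵖ⊗𝟙]≈𝟘 n) ,
      ¬IsZero-⊗ (Dn n) (dᵖ n ⊗ 𝟙) Dn≢0 (dᵖ⊗𝟙≢0 n 1+n≤p)

  Cartier⇒coeff≡0 : ∀ c α → α % p ≡ 0 → CartierIs p f (elt [] c f) (scaledOmegaCoeff α f) →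
    VanishesFrom (c ⊗ g) (p ∸ 1 + p) → coeff (c ⊗ g) (p ∸ 1) % p ≡ 0
  Cartier⇒coeff≡0 c α α≡0 (u , den≢0 , h≈Σ , u[p-1]≈αω) vcg =
    Exact-⊗-constant⇒coeff≡0 (Dn p) (c ⊗ g) (p ∸ 1) Dn≢0 DDn≈0 suc[p∸1]≡p vcg
      (Exact-cong (≈-sym cg⊗Dn≈Nfg) exact)
    where
    open ≈-Reasoning
    top≈𝟘 : num1 (u (p ∸ 1)) ≈ 𝟘
    top≈𝟘 = ⊗-cancelˡ f (num1 (u (p ∸ 1))) 𝟘 f≢0 (begin
      f ⊗ num1 (u (p ∸ 1))        ≈⟨ pmul-comm-≈ f (num1 (u (p ∸ 1))) ⟩
      num1 (u (p ∸ 1)) ⊗ f        ≈⟨ ⟨ proj₂ u[p-1]≈αω ⟩ ⟩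
      κ α ⊗ den (u (p ∸ 1))       ≈⟨ pmul-congˡ-≈ (den (u (p ∸ 1))) (≈-trans (κ-mod (trans α≡0 (sym 0%p≡0))) κ0≈𝟘) ⟩
      𝟘                           ≈⟨ ≈-sym (⊗-zeroʳ f) ⟩
      f ⊗ 𝟘                       ∎)
    y-part≈𝟘 : ∀ i → suc i ≡ p → num1 (u i) ≈ 𝟘
    y-part≈𝟘 i 1+i≡p = subst (λ j → num1 (u j) ≈ 𝟘) (cong (_∸ 1) (sym 1+i≡p)) top≈𝟘
    den[u]≢0 : ∀ i → i < p → ¬ IsZero (den (u i))
    den[u]≢0 i i<p = NonZeroPoly⇒¬IsZero (den (u i)) (den≢0 i i<p)
    open BasisSum u den[u]≢0 y-part≈𝟘
    exact : Exact (N p ⊗ f ⊗ g)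
    exact = proj₁ (invariant p ≤-refl)
    DDn≈0 : D (Dn p) ≈ 𝟘
    DDn≈0 = proj₁ (proj₂ (invariant p ≤-refl))
    Dn≢0 : ¬ IsZero (Dn p)
    Dn≢0 = proj₂ (proj₂ (invariant p ≤-refl))
    cg⊗Dn≈Nfg : c ⊗ g ⊗ Dn p ≈ N p ⊗ f ⊗ g
    cg⊗Dn≈Nfg = begin
      c ⊗ g ⊗ Dn p       ≈⟨ solve 3 (λ c g d → c :* g :* d := g :* (c :* d)) ≈-refl c g (Dn p) ⟩
      g ⊗ (c ⊗ Dn p)     ≈⟨ pmul-congʳ-≈ g ⟨ proj₂ h≈Σ ⟩ ⟩
      g ⊗ (N p ⊗ f)      ≈⟨ solve 3 (λ g n f → g :* (n :* f) := n :* f :* g) ≈-refl g (N p) f ⟩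
      N p ⊗ f ⊗ g        ∎

  3m+2≤[p∸1]+p : suc (suc (3 * m)) ≤ p ∸ 1 + p
  3m+2≤[p∸1]+p = subst (λ q → suc (suc (3 * m)) ≤ q ∸ 1 + q) (sym p≡3+r)
                       (≤-trans (m≤m+n (suc (suc (3 * m))) m') (≤-reflexive (arith m')))
    where
    arith : ∀ x → suc (suc (3 * suc x)) + x ≡ 2 + (x + x) + (3 + (x + x))
    arith = solve-∀
      where open import Data.Nat.Tactic.RingSolver

  ω-coefficient : ∀ α → α % p ≡ 0 → CartierIs p f (omegaCoeff f) (scaledOmegaCoeff α f) → coeff g (p ∸ 1) % p ≡ 0
  ω-coefficient α α≡0 Cω = trans (sym (≈-coeff (⊗-identityˡ g) (p ∸ 1)))
    (Cartier⇒coeff≡0 𝟙 α α≡0 Cω (vanishesFrom-cong (p ∸ 1 + p) (≈-sym (⊗-identityˡ g))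
      (vanishesFrom-mono g (≤-trans (n≤1+n _) 3m+2≤[p∸1]+p) (ppow-f-vanishesFrom m))))

  η-coefficient : ∀ β → β % p ≡ 0 → CartierIs p f (etaCoeff f) (scaledOmegaCoeff β f) → coeff g (p ∸ 2) % p ≡ 0
  η-coefficient β β≡0 Cη = subst (λ j → coeff (0 ∷ g) j % p ≡ 0) p∸1≡1+[p∸2]
    (trans (≈-coeff (0∷≈X⊗ g) (p ∸ 1))
      (Cartier⇒coeff≡0 X β β≡0 Cη (vanishesFrom-mono (X ⊗ g) 3m+2≤[p∸1]+p
        (vanishesFrom-⊗ 1 X g (suc (3 * m)) X-vanishesFrom-2 (ppow-f-vanishesFrom m)))))
    where
    p∸1≡1+[p∸2] : p ∸ 1 ≡ suc (p ∸ 2)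
    p∸1≡1+[p∸2] = subst (λ q → q ∸ 1 ≡ suc (q ∸ 2)) (sym p≡3+r) refl
    X-vanishesFrom-2 : VanishesFrom X 2
    X-vanishesFrom-2 1                (s≤s ())
    X-vanishesFrom-2 (suc (suc n)) _ = 0%p≡0

  Cartier-ω,η-not-both-zero : ∀ α β → CartierIs p f (omegaCoeff f) (scaledOmegaCoeff α f) →
    CartierIs p f (etaCoeff f) (scaledOmegaCoeff β f) → ¬ (α % p ≡ 0 × β % p ≡ 0)
  Cartier-ω,η-not-both-zero α β Cω Cη (α≡0 , β≡0) =
    coeff-g[p∸2,p∸1]-not-both-zero (η-coefficient β β≡0 Cη) (ω-coefficient α α≡0 Cω)

odd-prime-half : ∀ p → Prime p → p ≢ 2 → Σ ℕ λ m' → p ≡ suc (suc m' + suc m')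
odd-prime-half p p-prime p≢2 = from-parity (p % 2) refl (m≡m%n+[m/n]*n p 2) (m%n<n p 2)
  where
  from-parity : ∀ b → p % 2 ≡ b → p ≡ b + p / 2 * 2 → b < 2 → Σ ℕ λ m' → p ≡ suc (suc m' + suc m')
  from-parity 0 p%2≡0 _ _ with prime⇒irreducible p-prime (m%n≡0⇒n∣m p 2 p%2≡0)
  ... | inj₁ ()
  ... | inj₂ 2≡p = ⊥-elim (p≢2 (sym 2≡p))
  from-parity 1 _ p≡1+[p/2]*2 _ with p / 2 | p≡1+[p/2]*2
  ... | zero  | p≡1 = ⊥-elim (<-irrefl (sym p≡1) (nonTrivial⇒n>1 p {{prime⇒nonTrivial p-prime}}))
  ... | suc k | p≡1+[1+k]*2 = k , trans p≡1+[1+k]*2 (arith k)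
    where
    arith : ∀ k → 1 + suc k * 2 ≡ suc (suc k + suc k)
    arith = solve-∀
      where open import Data.Nat.Tactic.RingSolver
  from-parity (suc (suc b)) _ _ (s≤s (s≤s ()))

proposition7p7 : (p : ℕ) .{{_ : NonZero p}} → Prime p → p ≢ 2 →
    (a0 a1 a2 : ℕ) → Separable p (cubic a0 a1 a2) →
    (α β : ℕ) →
    CartierIs p (cubic a0 a1 a2) (omegaCoeff (cubic a0 a1 a2)) (scaledOmegaCoeff α (cubic a0 a1 a2)) →
    CartierIs p (cubic a0 a1 a2) (etaCoeff (cubic a0 a1 a2)) (scaledOmegaCoeff β (cubic a0 a1 a2)) →
    ¬ (α % p ≡ 0 × β % p ≡ 0)
proposition7p7 p p-prime p≢2 a0 a1 a2 separable α β Cω Cη with odd-prime-half p p-prime p≢2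
... | m' , p≡1+2m = Cartier-ω,η-not-both-zero α β Cω Cη
  where open FunctionField p p-prime a0 a1 a2 separable m' p≡1+2m
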